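{- Let $R=i_1i_2\cdots i_L$ be a word in the alphabet $\{1,\dots,n-1\}$. Then for every prime power $q$ and every $w\in S_n$, \[\mathbb P_{R,q}(w)=\frac{\mathrm{wt}_R(w)}{(1+q)^L}.\]
   Context: $S_n$ has simple transpositions $s_i=(i\ i+1)$ and length function $\ell$; $e$ is the identity. Bott--Samelson distribution: for a prime power $q$, with $B\subset \mathrm{GL}_n(\mathbb F_q)$ the upper triangular matrices, $E_\bullet$ the standard flag and $X_w^\circ=B\cdot E^w_\bullet$ ($E^w_i=\langle e_{w(1)},\dots,e_{w(i)}\rangle$), the Bott--Samelson variety of $R$ is the set of sequences of complete flags $(F^{(0)}_\bullet,\dots,F^{(L)}_\bullet)$ in $\mathbb F_q^n$ with $F^{(0)}_\bullet=E_\bullet$ and $F^{(r-1)}_k=F^{(r)}_k$ for $k\ne i_r$; $\pi_R$ maps it to $F^{(L)}_\bullet$; and $\mathbb P_{R,q}(w)=|\pi_R^{ -1}(X_w^\circ)|/(q+1)^L$. Weights: a subword $T$ of $R$ is a set of positions $a_1<\dots<a_m$ in $[L]$. Set $x_0=e$, $d_0=0$. For $k=1,\dots,L$: let $\varepsilon_k=1$ if $k\in\{a_1,\dots,a_m\}$ and $0$ otherwise; let $\gamma_k=1$ if $\ell(x_{k-1}s_{i_k})>\ell(x_{k-1})$ and $0$ otherwise; set $d_k=d_{k-1}+1$ if $\varepsilon_k=\gamma_k$ and $d_k=d_{k-1}$ otherwise; set $x_k=x_{k-1}s_{i_k}$ if $k$ is selected and $x_k=x_{k-1}$ otherwise. Put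 $\mathrm{wt}_R(T)=q^{d_L}$, and for $x\in S_n$, $\mathrm{wt}_R(x)=\sum \mathrm{wt}_R(T)$ over all subwords $T$ with $s_{i_{a_1}}\cdots s_{i_{a_m}}=x$. -}

module Defs where

open import Data.Bool using (Bool; true; false; if_then_else_; _∧_)
open import Data.Nat as ℕ using (ℕ; zero; suc; pred; _^_; NonZero)
open import Data.Nat.Properties using (m^n≢0)
open import Data.Fin as Fin using (Fin; toℕ; inject₁; inject≤)
open import Data.Fin.Properties using (_≟_; _<?_; all?; toℕ≤pred[n])
open import Data.Fin.Permutation using (Permutation′; _⟨$⟩ʳ_)
open import Data.List as List using (List; []; _∷_; length; concatMap; _++_)
open import Data.List.Membership.Propositional using (_∈_)
open import Data.List.Relation.Unary.Unique.Propositional using (Unique)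
open import Data.Vec as Vec using (Vec; []; _∷_; lookup; tabulate; zipWith; replicate; fromList)
open import Data.Nat.ListAction using (sum)
open import Data.Product using (Σ; ∃; ∃-syntax; _×_; _,_)
open import Data.Integer using (+_)
open import Data.Rational using (ℚ; _/_)
open import Relation.Nullary using (¬_; does)
open import Relation.Binary.PropositionalEquality using (_≡_; _≢_)
open import Algebra.Structures using (IsCommutativeRing)
open import Function using (_∘_; id)

HasCard : {A : Set} → (A → Set) → ℕ → Set
HasCard {A} P N = Σ (List A) λ xs → (length xs ≡ N) × Unique xs ×
                  (∀ x → (x ∈ xs → P x) × (P x → x ∈ xs))

record FiniteField : Set₁ where
  field
    F      : Set
    _+_    : F → F → F
    _*_    : F → F → F
    -_     : F → F
    0#     : F
    1#     : F
    isCommutativeRing : IsCommutativeRing _≡_ _+_ _*_ -_ 0# 1#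
    0≢1    : 0# ≢ 1#
    inverse : ∀ x → x ≢ 0# → Σ F λ y → x * y ≡ 1#
    elems    : List F
    complete : ∀ x → x ∈ elems
    unique   : Unique elems

  q : ℕ
  q = length elems

-- A letter i : Fin (pred n) (0-based) stands for the paper's letter i+1,
-- i.e. s_{i+1} = (i+1 i+2) in 1-based notation = swap of positions
-- i and i+1 in 0-based notation.

swap : ∀ {n} → Fin n → Fin n → Fin n → Fin n
swap a b j = if does (j ≟ a) then b else (if does (j ≟ b) then a else j)

sᵢ : ∀ {n} → Fin (pred n) → Fin n → Fin n
sᵢ {suc m} i = swap (inject₁ i) (Fin.suc i)

ΣFin : ∀ n → (Fin n → ℕ) → ℕ
ΣFin n f = sum (List.map f (List.allFin n))

ℓ : ∀ {n} → (Fin n → Fin n) → ℕ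
ℓ {n} x = ΣFin n λ a → ΣFin n λ b →
  if does (a <? b) ∧ does (x b <? x a) then 1 else 0

_≈?_ : ∀ {n} → (Fin n → Fin n) → (Fin n → Fin n) → Bool
x ≈? y = does (all? (λ j → x j ≟ y j))

-- Weights.  A subword T of R (a set of positions) is encoded by its
-- characteristic vector ε ∈ Vec Bool L.

Word : ℕ → Set
Word n = List (Fin (pred n))

allSubwords : ∀ L → List (Vec Bool L)
allSubwords zero    = [] ∷ []
allSubwords (suc L) = List.map (false ∷_) (allSubwords L) ++ List.map (true ∷_) (allSubwords L)

γ : ∀ {n} → (Fin n → Fin n) → Fin (pred n) → Bool
γ x i = does (ℓ x ℕ.<? ℓ (x ∘ sᵢ i))

eqB : Bool → Bool → Bool
eqB true  true  = true
eqB false false = true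
eqB _     _     = false

-- the walk x_0 = e, d_0 = 0, ...; returns d_L given x_{k-1}, d_{k-1}
dWalk : ∀ {n} → (Fin n → Fin n) → ℕ → (R : Word n) → Vec Bool (length R) → ℕ
dWalk x d []      []      = d
dWalk x d (i ∷ R) (ε ∷ E) =
  dWalk (if ε then x ∘ sᵢ i else x) (if eqB ε (γ x i) then suc d else d) R E

subwordProd : ∀ {n} → (R : Word n) → Vec Bool (length R) → Fin n → Fin n
subwordProd []      []          = id
subwordProd (i ∷ R) (true ∷ E)  = sᵢ i ∘ subwordProd R E
subwordProd (i ∷ R) (false ∷ E) = subwordProd R E

wtT : ∀ {n} → ℕ → (R : Word n) → Vec Bool (length R) → ℕ
wtT {n} q R E = q ^ dWalk {n} id 0 R E

wt : ∀ {n} → ℕ → (R : Word n) → Permutation′ n → ℕ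
wt {n} q R x = sum (List.map
  (λ E → if subwordProd {n} R E ≈? (x ⟨$⟩ʳ_) then wtT {n} q R E else 0)
  (allSubwords (length R)))

over1+q^ : ℕ → ℕ → ℕ → ℚ
over1+q^ a q L = (+ a) / ((suc q) ^ L)
  where instance _ : NonZero ((suc q) ^ L)
                 _ = m^n≢0 (suc q) L

module Geometry (𝔽 : FiniteField) where
  open FiniteField 𝔽

  V : ℕ → Set
  V n = Vec F n

  0ᵥ : ∀ {n} → V n
  0ᵥ = replicate _ 0#

  _+ᵥ_ : ∀ {n} → V n → V n → V n
  _+ᵥ_ = zipWith _+_

  _·ᵥ_ : ∀ {n} → F → V n → V n
  c ·ᵥ v = Vec.map (c *_) v

  lincomb : ∀ {n k} → Vec F k → Vec (V n) k → V n
  lincomb []       []       = 0ᵥ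
  lincomb (c ∷ cs) (b ∷ bs) = (c ·ᵥ b) +ᵥ lincomb cs bs

  InSpan : ∀ {n k} → Vec (V n) k → V n → Set
  InSpan b v = ∃[ c ] lincomb c b ≡ v

  LinIndep : ∀ {n k} → Vec (V n) k → Set
  LinIndep {k = k} b = ∀ c → lincomb c b ≡ 0ᵥ → ∀ (t : Fin k) → lookup c t ≡ 0#

  e : ∀ {n} → Fin n → V n
  e j = tabulate λ l → if does (j ≟ l) then 1# else 0#

  vecsL : ∀ n → List (V n)
  vecsL zero    = [] ∷ []
  vecsL (suc n) = concatMap (λ a → List.map (a ∷_) (vecsL n)) elems

  vecs : ∀ n → Vec (V n) (length (vecsL n))
  vecs n = fromList (vecsL n)

  record Subset (n : ℕ) : Set where
    constructor mkSubset
    field bits : Vec Bool (length (vecsL n))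

  _∈ₛ_ : ∀ {n} → V n → Subset n → Set
  _∈ₛ_ {n} v U = ∃[ i ] (lookup (vecs n) i ≡ v) × (lookup (Subset.bits U) i ≡ true)

  HasDim : ∀ {n} → Subset n → ℕ → Set
  HasDim {n} U k = Σ (Vec (V n) k) λ b → LinIndep b ×
                     (∀ v → (v ∈ₛ U → InSpan b v) × (InSpan b v → v ∈ₛ U))

  -- complete flags F_0 ⊂ F_1 ⊂ ⋯ ⊂ F_n, dim F_k = k (index k = dimension)
  Flag : ℕ → Set
  Flag n = Vec (Subset n) (suc n)

  IsFlag : ∀ {n} → Flag n → Set
  IsFlag {n} Fl = (∀ (k : Fin (suc n)) → HasDim (lookup Fl k) (toℕ k)) ×
                  (∀ (k : Fin n) v → v ∈ₛ lookup Fl (inject₁ k) → v ∈ₛ lookup Fl (Fin.suc k))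

  basisW : ∀ {n} → (Fin n → Fin n) → (k : Fin (suc n)) → Vec (V n) (toℕ k)
  basisW {n} w k = tabulate λ t → e (w (inject≤ t (toℕ≤pred[n] k)))

  IsStandardFlag : ∀ {n} → Flag n → Set
  IsStandardFlag {n} Fl = ∀ (k : Fin (suc n)) v →
    (v ∈ₛ lookup Fl k → InSpan (basisW id k) v) × (InSpan (basisW id k) v → v ∈ₛ lookup Fl k)

  Mat : ℕ → Set
  Mat n = Vec (V n) n

  entry : ∀ {n} → Mat n → Fin n → Fin n → F
  entry A i j = lookup (lookup A i) j

  dot : ∀ {n} → V n → V n → F
  dot u v = Vec.foldr _ _+_ 0# (zipWith _*_ u v)

  _·_ : ∀ {n} → Mat n → V n → V n
  A · v = Vec.map (λ row → dot row v) A

  _⊗_ : ∀ {n} → Mat n → Mat n → Mat n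
  _⊗_ {n} A C = tabulate λ i → tabulate λ j →
    Vec.foldr _ _+_ 0# (tabulate λ l → entry A i l * entry C l j)

  Iₙ : ∀ {n} → Mat n
  Iₙ = tabulate e

  InB : ∀ {n} → Mat n → Set
  InB {n} b = (∀ i j → toℕ j ℕ.< toℕ i → entry b i j ≡ 0#) ×
              (∃[ c ] (b ⊗ c ≡ Iₙ) × (c ⊗ b ≡ Iₙ))

  InSchubertCell : ∀ {n} → (Fin n → Fin n) → Flag n → Set
  InSchubertCell {n} w Fl = ∃[ b ] InB b × (∀ (k : Fin (suc n)) v →
    (v ∈ₛ lookup Fl k → ∃[ u ] InSpan (basisW w k) u × (b · u ≡ v)) ×
    ((∃[ u ] InSpan (basisW w k) u × (b · u ≡ v)) → v ∈ₛ lookup Fl k))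

  IsBS : ∀ {n} → (R : Word n) → Vec (Flag n) (suc (length R)) → Set
  IsBS {n} R Fs = (∀ r → IsFlag {n} (lookup Fs r)) ×
                  IsStandardFlag {n} (lookup Fs Fin.zero) ×
                  (∀ (r : Fin (length R)) (k : Fin (suc n)) →
                     toℕ k ≢ suc (toℕ (List.lookup R r)) →
                     lookup (lookup Fs (inject₁ r)) k ≡ lookup (lookup Fs (Fin.suc r)) k)

  BSFiber : ∀ {n} → (R : Word n) → Permutation′ n → Vec (Flag n) (suc (length R)) → Set
  BSFiber {n} R w Fs = IsBS R Fs × InSchubertCell (w ⟨$⟩ʳ_) (Vec.last Fs)

{-# OPTIONS --safe #-}
module Submission where

-- Over F_q, a flag b·E^x with b upper triangular determines the permutation x (Bruhat
-- decomposition), and X_w° consists of the flags b·E^w.  Fix such a flag and a letter i.  The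
-- flags that agree with it except in dimension i+1 correspond to the q + 1 lines of F_{i+2}/F_i:
-- writing x′ for the one of x, x sᵢ with an ascent at i and x″ for the other, they are b·E^{x′}
-- and the q flags (b (I + α E_{x′(i) x′(i+1)}))·E^{x″}, α ∈ F_q.  So the points of the
-- Bott–Samelson variety over X_w° are enumerated by the subwords of R with product w, the k-th
-- step offering q choices exactly when ε_k = γ_k; their number is the sum of the q^{d_L}, i.e. wt_R(w).

open import Defs
open import Algebra.Bundles using (CommutativeRing)
import Algebra.Properties.CommutativeSemigroup as CommutativeSemigroupₚ
open import Data.Bool using (Bool; true; false; if_then_else_; _∧_)
open import Data.Bool.Properties using (if-float)
open import Data.Fin as Fin using (Fin; zero; suc; toℕ; inject₁; inject≤; fromℕ<; _<_)
open import Data.Fin.Induction using (>-wellFounded)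
open import Data.Fin.Permutation using (Permutation′; _⟨$⟩ʳ_; _⟨$⟩ˡ_; inverseˡ; inverseʳ)
open import Data.Fin.Properties as Finₚ
  using (_≟_; _<?_; all?; suc-injective; toℕ-inject₁; toℕ-inject≤; toℕ≤pred[n]; toℕ<n; toℕ-injective; toℕ-fromℕ<; <-cmp)
open import Data.List as List using (List; []; _∷_; length; _++_)
open import Data.List.Membership.Propositional using (_∈_; find; lose)
open import Data.List.Membership.Propositional.Properties
  using (∈-lookup; ∈-map⁺; ∈-map⁻; ∈-concat⁺′; ∈-concat⁻′; ∈-cartesianProductWith⁺)
open import Data.List.Membership.Setoid.Properties using (index-injective)
import Data.List.Properties as Listₚ
open import Data.List.Relation.Unary.All as All using (All; []; _∷_)
open import Data.List.Relation.Unary.All.Properties as Allₚ using (¬All⇒Any¬)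
open import Data.List.Relation.Unary.AllPairs as AllPairs using ([]; _∷_)
import Data.List.Relation.Unary.AllPairs.Properties as AllPairsₚ
open import Data.List.Relation.Unary.Any as Any using (here; there)
open import Data.List.Relation.Unary.Any.Properties using (lookup-index)
open import Data.List.Relation.Unary.Unique.Propositional using (Unique)
open import Data.List.Relation.Unary.Unique.Propositional.Properties as Uniqueₚ using (cartesianProductWith⁺)
open import Data.Maybe using (Maybe; just; nothing)
open import Data.Nat as ℕ using (ℕ; _≤_; z≤n)
open import Data.Nat.ListAction using (sum)
import Data.Nat.ListAction.Properties as ListActionₚ
import Data.Nat.Properties as ℕₚ
open import Data.Nat.Solver using (module +-*-Solver)
open import Data.Product using (∃-syntax; _×_; _,_; proj₁; proj₂)
open import Data.Sum using (_⊎_; inj₁; inj₂; [_,_]′)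
open import Data.Vec as Vec using (Vec; []; _∷_; lookup; tabulate)
open import Data.Vec.Properties as Vecₚ using (lookup-map; lookup-zipWith; lookup-replicate; lookup∘tabulate; ≡-dec)
open import Data.Vec.Relation.Binary.Pointwise.Extensional using (ext; Pointwise-≡⇒≡)
open import Function using (_∘_; id; Injective)
import Induction.WellFounded as WF
open import Relation.Binary using (DecidableEquality; tri<; tri≈; tri>)
open import Relation.Binary.PropositionalEquality
  using (_≡_; _≢_; _≗_; refl; sym; trans; cong; cong₂; subst; subst₂; setoid; module ≡-Reasoning)
open import Relation.Nullary using (¬_; Dec; yes; no; does; contradiction)
open import Relation.Nullary.Decidable using (map′; dec-true; dec-false; _×-dec_; _→-dec_)
open import Relation.Unary using (Decidable)

module _ {A : Set} where

  Unique⇒lookup-injective : ∀ {xs : List A} → Unique xs → Injective _≡_ _≡_ (List.lookup xs)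
  Unique⇒lookup-injective {_ ∷ _} (_ ∷ _)   {zero}  {zero}  _  = refl
  Unique⇒lookup-injective {_ ∷ _} (x∉ ∷ _)  {zero}  {suc j} eq = contradiction eq (All.lookup x∉ (∈-lookup j))
  Unique⇒lookup-injective {_ ∷ _} (x∉ ∷ _)  {suc i} {zero}  eq = contradiction (sym eq) (All.lookup x∉ (∈-lookup i))
  Unique⇒lookup-injective {_ ∷ _} (_ ∷ xs!) {suc i} {suc j} eq = cong suc (Unique⇒lookup-injective xs! eq)

  ≡-dec-from-enumeration : (xs : List A) → (∀ x → x ∈ xs) → DecidableEquality A
  ≡-dec-from-enumeration xs complete x y =
    map′ (index-injective (setoid A) (complete x) (complete y)) (λ { refl → refl })
         (Any.index (complete x) ≟ Any.index (complete y))

module _ {A B C : Set} where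

  concatMap-map≡cartesianProductWith : ∀ (f : A → B → C) xs ys →
    List.concatMap (λ a → List.map (f a) ys) xs ≡ List.cartesianProductWith f xs ys
  concatMap-map≡cartesianProductWith f []       ys = refl
  concatMap-map≡cartesianProductWith f (x ∷ xs) ys =
    cong (List.map (f x) ys List.++_) (concatMap-map≡cartesianProductWith f xs ys)

  length-cartesianProductWith : ∀ (f : A → B → C) xs ys →
    length (List.cartesianProductWith f xs ys) ≡ length xs ℕ.* length ys
  length-cartesianProductWith f []       ys = refl
  length-cartesianProductWith f (x ∷ xs) ys = trans (Listₚ.length-++ (List.map (f x) ys))
    (cong₂ ℕ._+_ (Listₚ.length-map (f x) ys) (length-cartesianProductWith f xs ys))

module _ {A B : Set} (f : A → List B) where

  ∈-concatMap⁺ : ∀ {a xs y} → a ∈ xs → y ∈ f a → y ∈ List.concatMap f xs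
  ∈-concatMap⁺ a∈xs y∈fa = ∈-concat⁺′ y∈fa (∈-map⁺ f a∈xs)

  ∈-concatMap⁻ : ∀ xs {y} → y ∈ List.concatMap f xs → ∃[ a ] a ∈ xs × y ∈ f a
  ∈-concatMap⁻ xs y∈ with ∈-concat⁻′ (List.map f xs) y∈
  ... | ys , y∈ys , ys∈ with ∈-map⁻ f ys∈
  ... | a , a∈xs , refl = a , a∈xs , y∈ys

  length-concatMap-map : ∀ {C : Set} (g : C → A) {c} → (∀ a → length (f (g a)) ≡ c) →
                         ∀ xs → length (List.concatMap f (List.map g xs)) ≡ length xs ℕ.* c
  length-concatMap-map g fg≡c []       = refl
  length-concatMap-map g fg≡c (a ∷ as) =
    trans (Listₚ.length-++ (f (g a))) (cong₂ ℕ._+_ (fg≡c a) (length-concatMap-map g fg≡c as))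

lookup-fromList : ∀ {A : Set} (xs : List A) i → Vec.lookup (Vec.fromList xs) i ≡ List.lookup xs i
lookup-fromList (x ∷ xs) zero    = refl
lookup-fromList (x ∷ xs) (suc i) = lookup-fromList xs i

HasCard-cong : ∀ {A : Set} {P Q : A → Set} {a} → (∀ x → P x → Q x) → (∀ x → Q x → P x) → HasCard P a → HasCard Q a
HasCard-cong P⇒Q Q⇒P (xs , |xs| , xs! , mem) =
  xs , |xs| , xs! , λ x → P⇒Q x ∘ proj₁ (mem x) , proj₂ (mem x) ∘ Q⇒P x

HasCard-∈ : ∀ {A : Set} {xs : List A} → Unique xs → HasCard (_∈ xs) (length xs)
HasCard-∈ {xs = xs} xs! = xs , refl , xs! , λ _ → id , id

module _ {A B : Set} {P : A → Set} {Q : B → Set} where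

  HasCard-≤ : ∀ {a b} → HasCard P a → HasCard Q b →
              (f : A → B) → Injective _≡_ _≡_ f → (∀ x → P x → Q (f x)) → a ≤ b
  HasCard-≤ (xs , refl , xs! , memP) (ys , refl , _ , memQ) f f-inj P⇒Qf =
    Finₚ.injective⇒≤ {f = position} position-injective
    where
    f∈ys : ∀ i → f (List.lookup xs i) ∈ ys
    f∈ys i = proj₂ (memQ _) (P⇒Qf _ (proj₁ (memP _) (∈-lookup i)))
    position : Fin (length xs) → Fin (length ys)
    position i = Any.index (f∈ys i)
    position-injective : Injective _≡_ _≡_ position
    position-injective eq =
      Unique⇒lookup-injective xs! (f-inj (index-injective (setoid B) (f∈ys _) (f∈ys _) eq))

module _ {A : Set} {P Q : A → Set} where

  HasCard-≡ : ∀ {a b} → HasCard P a → HasCard Q b → (∀ x → P x → Q x) → (∀ x → Q x → P x) → a ≡ b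
  HasCard-≡ cP cQ P⇒Q Q⇒P = ℕₚ.≤-antisym (HasCard-≤ cP cQ id id P⇒Q) (HasCard-≤ cQ cP id id Q⇒P)

  HasCard-<⇒∃¬ : ∀ {a b} → HasCard P a → HasCard Q b → a ℕ.< b → Decidable P → ∃[ z ] Q z × ¬ P z
  HasCard-<⇒∃¬ cP cQ@(ys , _ , _ , memQ) a<b P? with All.all? P? ys
  ... | yes allP = contradiction (HasCard-≤ cQ cP id id (λ z → All.lookup allP ∘ proj₂ (memQ z))) (ℕₚ.<⇒≱ a<b)
  ... | no ¬allP with find (¬All⇒Any¬ P? ys ¬allP)
  ...   | z , z∈ys , ¬Pz = z , proj₁ (memQ z) z∈ys , ¬Pz

  HasCard-≥⇒⊇ : ∀ {a b} → HasCard P a → HasCard Q b → b ≤ a → (∀ x → P x → Q x) → Decidable P →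
                ∀ x → Q x → P x
  HasCard-≥⇒⊇ (xs , refl , xs! , memP) cQ b≤a P⇒Q P? y Qy with P? y
  ... | yes Py = Py
  ... | no ¬Py = contradiction (HasCard-≤ cP+y cQ id id P+y⇒Q) (ℕₚ.<⇒≱ (ℕ.s≤s b≤a))
    where
    P+y : A → Set
    P+y z = z ≡ y ⊎ P z
    y∉xs : All (y ≢_) xs
    y∉xs = All.tabulate λ {z} z∈xs y≡z → ¬Py (subst P (sym y≡z) (proj₁ (memP z) z∈xs))
    cP+y : HasCard P+y _
    cP+y = y ∷ xs , refl , y∉xs ∷ xs! , λ z →
      (λ { (here z≡y) → inj₁ z≡y ; (there z∈xs) → inj₂ (proj₁ (memP z) z∈xs) }) ,
      (λ { (inj₁ z≡y) → here z≡y ; (inj₂ Pz) → there (proj₂ (memP z) Pz) })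
    P+y⇒Q : ∀ z → P+y z → Q z
    P+y⇒Q z (inj₁ refl) = Qy
    P+y⇒Q z (inj₂ Pz)   = P⇒Q z Pz

does≡true⇒ : ∀ {P : Set} (P? : Dec P) → does P? ≡ true → P
does≡true⇒ (yes p) _ = p

does≡false⇒ : ∀ {P : Set} (P? : Dec P) → does P? ≡ false → ¬ P
does≡false⇒ (no ¬p) _ = ¬p

≈?⇒≗ : ∀ {n} {x y : Fin n → Fin n} → (x ≈? y) ≡ true → x ≗ y
≈?⇒≗ {x = x} {y} = does≡true⇒ (all? λ j → x j ≟ y j)

≗⇒≈? : ∀ {n} {x y : Fin n → Fin n} → x ≗ y → (x ≈? y) ≡ true
≗⇒≈? {x = x} {y} = dec-true (all? λ j → x j ≟ y j)

record IsPermutation {n} (x : Fin n → Fin n) : Set where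
  field
    from             : Fin n → Fin n
    strictlyInverseˡ : ∀ j → x (from j) ≡ j
    strictlyInverseʳ : ∀ t → from (x t) ≡ t

  injective : Injective _≡_ _≡_ x
  injective {a} {b} eq = trans (sym (strictlyInverseʳ a)) (trans (cong from eq) (strictlyInverseʳ b))

id-isPermutation : ∀ {n} → IsPermutation {n} id
id-isPermutation = record { from = id ; strictlyInverseˡ = λ _ → refl ; strictlyInverseʳ = λ _ → refl }

∘-involution-isPermutation : ∀ {n} {x σ : Fin n → Fin n} → IsPermutation x → (∀ t → σ (σ t) ≡ t) →
                             IsPermutation (x ∘ σ)
∘-involution-isPermutation {x = x} {σ} x-perm σ-invol = record
  { from             = σ ∘ from
  ; strictlyInverseˡ = λ j → trans (cong x (σ-invol _)) (strictlyInverseˡ j)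
  ; strictlyInverseʳ = λ t → trans (cong σ (strictlyInverseʳ (σ t))) (σ-invol t)
  }
  where open IsPermutation x-perm

ΣFin-suc : ∀ n (f : Fin (ℕ.suc n) → ℕ) → ΣFin (ℕ.suc n) f ≡ f zero ℕ.+ ΣFin n (f ∘ suc)
ΣFin-suc n f = cong (f zero ℕ.+_) (cong sum
  (trans (Listₚ.map-tabulate suc f) (sym (Listₚ.map-tabulate id (f ∘ suc)))))

ΣFin-cong : ∀ n {f g : Fin n → ℕ} → f ≗ g → ΣFin n f ≡ ΣFin n g
ΣFin-cong n f≗g = cong sum (Listₚ.map-cong f≗g (List.allFin n))

ΣFin-mono-≤ : ∀ n {f g : Fin n → ℕ} → (∀ a → f a ≤ g a) → ΣFin n f ≤ ΣFin n g
ΣFin-mono-≤ ℕ.zero    f≤g = z≤n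
ΣFin-mono-≤ (ℕ.suc n) {f} {g} f≤g = subst₂ _≤_ (sym (ΣFin-suc n f)) (sym (ΣFin-suc n g))
  (ℕₚ.+-mono-≤ (f≤g zero) (ΣFin-mono-≤ n (f≤g ∘ suc)))

ΣFin-mono-< : ∀ n {f g : Fin n → ℕ} → (∀ a → f a ≤ g a) → ∀ a₀ → f a₀ ℕ.< g a₀ → ΣFin n f ℕ.< ΣFin n g
ΣFin-mono-< (ℕ.suc n) {f} {g} f≤g zero f<g = subst₂ ℕ._<_ (sym (ΣFin-suc n f)) (sym (ΣFin-suc n g))
  (ℕₚ.+-mono-<-≤ f<g (ΣFin-mono-≤ n (f≤g ∘ suc)))
ΣFin-mono-< (ℕ.suc n) {f} {g} f≤g (suc a₀) f<g = subst₂ ℕ._<_ (sym (ΣFin-suc n f)) (sym (ΣFin-suc n g))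
  (ℕₚ.+-mono-≤-< (f≤g zero) (ΣFin-mono-< n (f≤g ∘ suc) a₀ f<g))

swap-≡ˡ : ∀ {n} (a b : Fin n) → swap a b a ≡ b
swap-≡ˡ a b with a ≟ a
... | yes _  = refl
... | no a≢a = contradiction refl a≢a

swap-≡ʳ : ∀ {n} {a b : Fin n} → a ≢ b → swap a b b ≡ a
swap-≡ʳ {a = a} {b} a≢b with b ≟ a | b ≟ b
... | yes b≡a | _      = contradiction (sym b≡a) a≢b
... | no _    | yes _  = refl
... | no _    | no b≢b = contradiction refl b≢b

swap-≢ : ∀ {n} {a b t : Fin n} → t ≢ a → t ≢ b → swap a b t ≡ t
swap-≢ {a = a} {b} {t} t≢a t≢b with t ≟ a | t ≟ b
... | yes t≡a | _       = contradiction t≡a t≢a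
... | no _    | yes t≡b = contradiction t≡b t≢b
... | no _    | no _    = refl

swap-suc : ∀ {n} (a b t : Fin n) → swap (suc a) (suc b) (suc t) ≡ suc (swap a b t)
swap-suc a b t with t ≟ a | t ≟ b
... | yes _ | _     = refl
... | no _  | yes _ = refl
... | no _  | no _  = refl

ΣFin-∘sᵢ : ∀ {m} (i : Fin m) (f : Fin (ℕ.suc m) → ℕ) → ΣFin (ℕ.suc m) (f ∘ sᵢ i) ≡ ΣFin (ℕ.suc m) f
ΣFin-∘sᵢ {ℕ.suc m} zero f = begin
  ΣFin (2 ℕ.+ m) (f ∘ sᵢ zero)
    ≡⟨ ΣFin-suc₂ (f ∘ sᵢ zero) ⟩
  f (suc zero) ℕ.+ (f zero ℕ.+ ΣFin m (f ∘ suc ∘ suc))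
    ≡⟨ CommutativeSemigroupₚ.x∙yz≈y∙xz ℕₚ.+-commutativeSemigroup (f (suc zero)) (f zero) _ ⟩
  f zero ℕ.+ (f (suc zero) ℕ.+ ΣFin m (f ∘ suc ∘ suc))
    ≡⟨ ΣFin-suc₂ f ⟨
  ΣFin (2 ℕ.+ m) f ∎
  where
  open ≡-Reasoning
  ΣFin-suc₂ : ∀ g → ΣFin (2 ℕ.+ m) g ≡ g zero ℕ.+ (g (suc zero) ℕ.+ ΣFin m (g ∘ suc ∘ suc))
  ΣFin-suc₂ g = trans (ΣFin-suc (ℕ.suc m) g) (cong (g zero ℕ.+_) (ΣFin-suc m (g ∘ suc)))
ΣFin-∘sᵢ {ℕ.suc m} (suc i) f = begin
  ΣFin (2 ℕ.+ m) (f ∘ sᵢ (suc i))                  ≡⟨ ΣFin-suc (ℕ.suc m) (f ∘ sᵢ (suc i)) ⟩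
  f zero ℕ.+ ΣFin (ℕ.suc m) (f ∘ sᵢ (suc i) ∘ suc) ≡⟨ cong (f zero ℕ.+_) (ΣFin-cong (ℕ.suc m) (cong f ∘ swap-suc _ _)) ⟩
  f zero ℕ.+ ΣFin (ℕ.suc m) (f ∘ suc ∘ sᵢ i)       ≡⟨ cong (f zero ℕ.+_) (ΣFin-∘sᵢ i (f ∘ suc)) ⟩
  f zero ℕ.+ ΣFin (ℕ.suc m) (f ∘ suc)              ≡⟨ ΣFin-suc (ℕ.suc m) f ⟨
  ΣFin (2 ℕ.+ m) f                                 ∎
  where open ≡-Reasoning

indicator-∧-mono : ∀ {A B C : Set} (A? : Dec A) (B? : Dec B) (C? : Dec C) → (A → C → B) →
                   (if does A? ∧ does C? then 1 else 0) ≤ (if does B? ∧ does C? then 1 else 0)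
indicator-∧-mono (no _)  _        _       _   = z≤n
indicator-∧-mono (yes _) (yes _)  _       _   = ℕₚ.≤-refl
indicator-∧-mono (yes a) (no ¬b)  (yes c) a⇒b = contradiction (a⇒b a c) ¬b
indicator-∧-mono (yes _) (no _)   (no _)  _   = z≤n

inversion : ∀ {n} → (Fin n → Fin n) → Fin n → Fin n → ℕ
inversion x a b = if does (a <? b) ∧ does (x b <? x a) then 1 else 0

ℓ-cong : ∀ {n} {x y : Fin n → Fin n} → x ≗ y → ℓ x ≡ ℓ y
ℓ-cong {n} x≗y = ΣFin-cong n λ a → ΣFin-cong n λ b →
  cong₂ (λ u v → if does (a <? b) ∧ does (u <? v) then 1 else 0) (x≗y b) (x≗y a)

module Letter {m : ℕ} (i : Fin m) where

  l r : Fin (ℕ.suc m)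
  l = inject₁ i
  r = suc i

  σ : Fin (ℕ.suc m) → Fin (ℕ.suc m)
  σ = sᵢ i

  l<r : l < r
  l<r = ℕₚ.≤-reflexive (cong ℕ.suc (toℕ-inject₁ i))

  l≢r : l ≢ r
  l≢r = Finₚ.<⇒≢ l<r

  l<⇒r≤ : ∀ {t : Fin (ℕ.suc m)} → l < t → r Fin.≤ t
  l<⇒r≤ {t} l<t = subst (λ k → ℕ.suc k ≤ toℕ t) (toℕ-inject₁ i) l<t

  <r⇒≤l : ∀ {t : Fin (ℕ.suc m)} → t < r → t Fin.≤ l
  <r⇒≤l {t} t<r = subst (toℕ t ≤_) (sym (toℕ-inject₁ i)) (ℕₚ.≤-pred t<r)

  σ-l : σ l ≡ r
  σ-l = swap-≡ˡ l r

  σ-r : σ r ≡ l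
  σ-r = swap-≡ʳ l≢r

  σ-other : ∀ {t} → t ≢ l → t ≢ r → σ t ≡ t
  σ-other = swap-≢

  σ-involutive : ∀ t → σ (σ t) ≡ t
  σ-involutive t = by-cases (t ≟ l) (t ≟ r)
    where
    by-cases : Dec (t ≡ l) → Dec (t ≡ r) → σ (σ t) ≡ t
    by-cases (yes refl) _          = trans (cong σ σ-l) σ-r
    by-cases (no _)     (yes refl) = trans (cong σ σ-r) σ-l
    by-cases (no t≢l)   (no t≢r)   = trans (cong σ (σ-other t≢l t≢r)) (σ-other t≢l t≢r)

  σ-monotone : ∀ {a b} → a < b → (a ≡ l × b ≡ r) ⊎ σ a < σ b
  σ-monotone {a} {b} a<b = by-cases (a ≟ l) (a ≟ r) (b ≟ l) (b ≟ r)
    where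
    by-cases : Dec (a ≡ l) → Dec (a ≡ r) → Dec (b ≡ l) → Dec (b ≡ r) → (a ≡ l × b ≡ r) ⊎ σ a < σ b
    by-cases (yes refl) _          _          (yes refl) = inj₁ (refl , refl)
    by-cases (yes refl) _          (yes refl) _          = contradiction a<b (Finₚ.<-irrefl refl)
    by-cases (yes refl) _          (no _)     (no b≢r)   =
      inj₂ (subst₂ _<_ (sym σ-l) (sym (σ-other (Finₚ.<⇒≢ a<b ∘ sym) b≢r))
                       (Finₚ.≤∧≢⇒< (l<⇒r≤ a<b) (b≢r ∘ sym)))
    by-cases (no _)     (yes refl) _          _          =
      inj₂ (subst₂ _<_ (sym σ-r) (sym (σ-other (Finₚ.<⇒≢ (Finₚ.<-trans l<r a<b) ∘ sym) (Finₚ.<⇒≢ a<b ∘ sym)))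
                       (Finₚ.<-trans l<r a<b))
    by-cases (no a≢l)   (no a≢r)   (yes refl) _          =
      inj₂ (subst₂ _<_ (sym (σ-other a≢l a≢r)) (sym σ-l) (Finₚ.<-trans a<b l<r))
    by-cases (no a≢l)   (no a≢r)   (no _)     (yes refl) =
      inj₂ (subst₂ _<_ (sym (σ-other a≢l a≢r)) (sym σ-r) (Finₚ.≤∧≢⇒< (<r⇒≤l a<b) a≢l))
    by-cases (no a≢l)   (no a≢r)   (no b≢l)   (no b≢r)   =
      inj₂ (subst₂ _<_ (sym (σ-other a≢l a≢r)) (sym (σ-other b≢l b≢r)) a<b)

  σ-inversion : (Fin (ℕ.suc m) → Fin (ℕ.suc m)) → Fin (ℕ.suc m) → Fin (ℕ.suc m) → ℕ
  σ-inversion x a b = if does (σ a <? σ b) ∧ does (x b <? x a) then 1 else 0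

  ℓ-∘σ : ∀ x → ℓ (x ∘ σ) ≡ ΣFin (ℕ.suc m) λ a → ΣFin (ℕ.suc m) (σ-inversion x a)
  ℓ-∘σ x = trans (sym (ΣFin-∘sᵢ i λ a → ΣFin _ (inversion (x ∘ σ) a)))
               (ΣFin-cong _ λ a → trans (sym (ΣFin-∘sᵢ i (inversion (x ∘ σ) (σ a)))) (ΣFin-cong _ λ b →
    cong₂ (λ u v → if does (σ a <? σ b) ∧ does (u <? v) then 1 else 0)
          (cong x (σ-involutive b)) (cong x (σ-involutive a))))

  -- After reindexing by σ, every inversion (a, b) of x is one of x ∘ σ (the exception (l, r)
  -- is not an inversion of x), and (r, l) is a new one.

  ℓ-ascent : ∀ x → x l < x r → ℓ x ℕ.< ℓ (x ∘ σ)
  ℓ-ascent x xl<xr = subst (ℓ x ℕ.<_) (sym (ℓ-∘σ x))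
    (ΣFin-mono-< _ (λ a → ΣFin-mono-≤ _ (inversion≤ a)) r (ΣFin-mono-< _ (inversion≤ r) l inversion<))
    where
    inversion≤ : ∀ a b → inversion x a b ≤ σ-inversion x a b
    inversion≤ a b = indicator-∧-mono (a <? b) (σ a <? σ b) (x b <? x a) λ a<b xb<xa →
      [ (λ { (refl , refl) → contradiction xl<xr (Finₚ.<-asym xb<xa) }) , id ]′ (σ-monotone a<b)
    inversion< : inversion x r l ℕ.< σ-inversion x r l
    inversion< rewrite dec-false (r <? l) (Finₚ.<-asym l<r)
                     | dec-true (σ r <? σ l) (subst₂ _<_ (sym σ-r) (sym σ-l) l<r)
                     | dec-true (x l <? x r) xl<xr = ℕₚ.0<1+n

  ℓ-descent : ∀ x → x r < x l → ℓ (x ∘ σ) ℕ.< ℓ x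
  ℓ-descent x xr<xl = subst (ℓ (x ∘ σ) ℕ.<_) (ℓ-cong (cong x ∘ σ-involutive))
    (ℓ-ascent (x ∘ σ) (subst₂ _<_ (cong x (sym σ-l)) (cong x (sym σ-r)) xr<xl))

  γ≡true⇒ascent : ∀ {x} → Injective _≡_ _≡_ x → γ x i ≡ true → x l < x r
  γ≡true⇒ascent {x} x-inj γ≡true with <-cmp (x l) (x r)
  ... | tri< xl<xr _ _ = xl<xr
  ... | tri≈ _ xl≡xr _ = contradiction (x-inj xl≡xr) l≢r
  ... | tri> _ _ xr<xl = contradiction (does≡true⇒ (ℓ x ℕ.<? ℓ (x ∘ σ)) γ≡true) (ℕₚ.<⇒≯ (ℓ-descent x xr<xl))

  γ≡false⇒descent : ∀ {x} → Injective _≡_ _≡_ x → γ x i ≡ false → x r < x l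
  γ≡false⇒descent {x} x-inj γ≡false with <-cmp (x l) (x r)
  ... | tri< xl<xr _ _ = contradiction (ℓ-ascent x xl<xr) (does≡false⇒ (ℓ x ℕ.<? ℓ (x ∘ σ)) γ≡false)
  ... | tri≈ _ xl≡xr _ = contradiction (x-inj xl≡xr) l≢r
  ... | tri> _ _ xr<xl = xr<xl

module Flags (𝔽 : FiniteField) where

  open FiniteField 𝔽 using (F; 0≢1; inverse; elems; complete; unique; q)
  open Geometry 𝔽

  commutativeRing : CommutativeRing _ _
  commutativeRing = record { isCommutativeRing = FiniteField.isCommutativeRing 𝔽 }

  open CommutativeRing commutativeRing
    using (_+_; _*_; -_; 0#; 1#; +-assoc; +-comm; +-identityˡ; +-identityʳ; -‿inverseˡ; -‿inverseʳ;
           *-assoc; *-comm; *-identityˡ; *-identityʳ; distribˡ; distribʳ; zeroˡ; zeroʳ; semiring; ring;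
           *-commutativeSemigroup)
  open CommutativeSemigroupₚ *-commutativeSemigroup using (x∙yz≈y∙xz; xy∙z≈xz∙y; xy∙z≈zy∙x)
  open import Algebra.Properties.Ring ring using (-‿distribˡ-*; x∙y⁻¹≈ε⇒x≈y; -1*x≈-x)
  open import Algebra.Properties.Semiring.Sum semiring
    using (sum-syntax; ∑-distrib-+; ∑-comm; *-distribˡ-sum; *-distribʳ-sum; sum-cong-≗; sum-replicate-zero)

  _≟F_ : DecidableEquality F
  _≟F_ = ≡-dec-from-enumeration elems complete

  x*y≡0⇒y≡0 : ∀ {x y} → x ≢ 0# → x * y ≡ 0# → y ≡ 0#
  x*y≡0⇒y≡0 {x} {y} x≢0 xy≡0 = begin
    y             ≡⟨ *-identityˡ y ⟨
    1# * y        ≡⟨ cong (_* y) (trans (sym xx⁻¹≡1) (*-comm x x⁻¹)) ⟩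
    (x⁻¹ * x) * y ≡⟨ *-assoc x⁻¹ x y ⟩
    x⁻¹ * (x * y) ≡⟨ cong (x⁻¹ *_) xy≡0 ⟩
    x⁻¹ * 0#      ≡⟨ zeroʳ x⁻¹ ⟩
    0#            ∎
    where
    open ≡-Reasoning
    x⁻¹ = proj₁ (inverse x x≢0)
    xx⁻¹≡1 = proj₂ (inverse x x≢0)

  x-[x*c⁻¹]*c≡0 : ∀ {c c⁻¹} x → c * c⁻¹ ≡ 1# → x + - (x * c⁻¹) * c ≡ 0#
  x-[x*c⁻¹]*c≡0 {c} {c⁻¹} x cc⁻¹≡1 = begin
    x + - (x * c⁻¹) * c   ≡⟨ cong (x +_) (-‿distribˡ-* (x * c⁻¹) c) ⟨
    x + - ((x * c⁻¹) * c) ≡⟨ cong (λ z → x + - z) (trans (*-assoc x c⁻¹ c) (cong (x *_) (trans (*-comm c⁻¹ c) cc⁻¹≡1))) ⟩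
    x + - (x * 1#)        ≡⟨ cong (λ z → x + - z) (*-identityʳ x) ⟩
    x + - x               ≡⟨ -‿inverseʳ x ⟩
    0#                    ∎
    where open ≡-Reasoning

  Vec-ext : ∀ {A : Set} {k} {u v : Vec A k} → (∀ t → lookup u t ≡ lookup v t) → u ≡ v
  Vec-ext = Pointwise-≡⇒≡ ∘ ext

  ∑-zero : ∀ {k} {f : Fin k → F} → (∀ l → f l ≡ 0#) → ∑[ l < k ] f l ≡ 0#
  ∑-zero {k} f≡0 = trans (sum-cong-≗ f≡0) (sum-replicate-zero k)

  ∑-single : ∀ {k} (f : Fin k → F) j → (∀ l → l ≢ j → f l ≡ 0#) → ∑[ l < k ] f l ≡ f j
  ∑-single f zero    f≡0 = trans (cong (f zero +_) (∑-zero λ l → f≡0 (suc l) λ ())) (+-identityʳ _)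
  ∑-single f (suc j) f≡0 = trans (cong₂ _+_ (f≡0 zero λ ()) (∑-single (f ∘ suc) j λ l l≢j → f≡0 (suc l) (l≢j ∘ suc-injective)))
                                 (+-identityˡ _)

  foldr-tabulate : ∀ {k} (f : Fin k → F) → Vec.foldr _ _+_ 0# (tabulate f) ≡ ∑[ l < k ] f l
  foldr-tabulate {ℕ.zero}  f = refl
  foldr-tabulate {ℕ.suc k} f = cong (f zero +_) (foldr-tabulate (f ∘ suc))

  dot-∑ : ∀ {k} (u v : V k) → dot u v ≡ ∑[ l < k ] (lookup u l * lookup v l)
  dot-∑ []      []      = refl
  dot-∑ (a ∷ u) (b ∷ v) = cong (a * b +_) (dot-∑ u v)

  lookup-+ᵥ : ∀ {k} (u v : V k) t → lookup (u +ᵥ v) t ≡ lookup u t + lookup v t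
  lookup-+ᵥ u v t = lookup-zipWith _+_ t u v

  lookup-·ᵥ : ∀ {k} c (v : V k) t → lookup (c ·ᵥ v) t ≡ c * lookup v t
  lookup-·ᵥ c v t = lookup-map t (c *_) v

  lookup-0ᵥ : ∀ {k} (t : Fin k) → lookup 0ᵥ t ≡ 0#
  lookup-0ᵥ t = lookup-replicate t 0#

  lookup-e-≡ : ∀ {k} (j : Fin k) → lookup (e j) j ≡ 1#
  lookup-e-≡ j = trans (lookup∘tabulate _ j) (cong (if_then 1# else 0#) (dec-true (j ≟ j) refl))

  lookup-e-≢ : ∀ {k} {j l : Fin k} → j ≢ l → lookup (e j) l ≡ 0#
  lookup-e-≢ {j = j} {l} j≢l = trans (lookup∘tabulate _ l) (cong (if_then 1# else 0#) (dec-false (j ≟ l) j≢l))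

  ∑-e* : ∀ {k} (j : Fin k) (f : Fin k → F) → ∑[ l < k ] (lookup (e j) l * f l) ≡ f j
  ∑-e* j f = trans (∑-single _ j λ l l≢j → trans (cong (_* f l) (lookup-e-≢ (l≢j ∘ sym))) (zeroˡ _))
                   (trans (cong (_* f j) (lookup-e-≡ j)) (*-identityˡ _))

  ∑-*e : ∀ {k} (j : Fin k) (f : Fin k → F) → ∑[ l < k ] (f l * lookup (e j) l) ≡ f j
  ∑-*e j f = trans (sum-cong-≗ λ l → *-comm (f l) _) (∑-e* j f)

  lookup-lincomb : ∀ {n k} (c : V k) (bs : Vec (V n) k) t →
                   lookup (lincomb c bs) t ≡ ∑[ s < k ] (lookup c s * lookup (lookup bs s) t)
  lookup-lincomb []       []       t = lookup-0ᵥ t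
  lookup-lincomb (c ∷ cs) (b ∷ bs) t =
    trans (lookup-+ᵥ (c ·ᵥ b) (lincomb cs bs) t) (cong₂ _+_ (lookup-·ᵥ c b t) (lookup-lincomb cs bs t))

  module _ {n : ℕ} where

    lookup-· : ∀ (A : Mat n) v i → lookup (A · v) i ≡ ∑[ l < n ] (entry A i l * lookup v l)
    lookup-· A v i = trans (lookup-map i (λ row → dot row v) A) (dot-∑ (lookup A i) v)

    entry-⊗ : ∀ (A C : Mat n) i j → entry (A ⊗ C) i j ≡ ∑[ l < n ] (entry A i l * entry C l j)
    entry-⊗ A C i j = trans (cong (λ row → lookup row j) (lookup∘tabulate _ i))
                            (trans (lookup∘tabulate _ j) (foldr-tabulate λ l → entry A i l * entry C l j))

    entry-Iₙ : ∀ (i j : Fin n) → entry Iₙ i j ≡ lookup (e i) j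
    entry-Iₙ i j = cong (λ row → lookup row j) (lookup∘tabulate e i)

    lookup-·-e : ∀ (A : Mat n) i j → lookup (A · e j) i ≡ entry A i j
    lookup-·-e A i j = trans (lookup-· A (e j) i) (∑-*e j (entry A i))

    ≡-by-columns : ∀ {A C : Mat n} → (∀ j → A · e j ≡ C · e j) → A ≡ C
    ≡-by-columns {A} {C} A≡C = Vec-ext λ i → Vec-ext λ j →
      trans (sym (lookup-·-e A i j)) (trans (cong (λ v → lookup v i) (A≡C j)) (lookup-·-e C i j))

    ·-+ᵥ : ∀ (A : Mat n) u v → A · (u +ᵥ v) ≡ (A · u) +ᵥ (A · v)
    ·-+ᵥ A u v = Vec-ext λ i → begin
      lookup (A · (u +ᵥ v)) i
        ≡⟨ lookup-· A (u +ᵥ v) i ⟩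
      ∑[ l < n ] (entry A i l * lookup (u +ᵥ v) l)
        ≡⟨ sum-cong-≗ (λ l → trans (cong (entry A i l *_) (lookup-+ᵥ u v l)) (distribˡ _ _ _)) ⟩
      ∑[ l < n ] (entry A i l * lookup u l + entry A i l * lookup v l)
        ≡⟨ ∑-distrib-+ (λ l → entry A i l * lookup u l) (λ l → entry A i l * lookup v l) ⟩
      ∑[ l < n ] (entry A i l * lookup u l) + ∑[ l < n ] (entry A i l * lookup v l)
        ≡⟨ cong₂ _+_ (lookup-· A u i) (lookup-· A v i) ⟨
      lookup (A · u) i + lookup (A · v) i
        ≡⟨ lookup-+ᵥ (A · u) (A · v) i ⟨
      lookup ((A · u) +ᵥ (A · v)) i ∎
      where open ≡-Reasoning

    ·-·ᵥ : ∀ (A : Mat n) c u → A · (c ·ᵥ u) ≡ c ·ᵥ (A · u)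
    ·-·ᵥ A c u = Vec-ext λ i → begin
      lookup (A · (c ·ᵥ u)) i
        ≡⟨ lookup-· A (c ·ᵥ u) i ⟩
      ∑[ l < n ] (entry A i l * lookup (c ·ᵥ u) l)
        ≡⟨ sum-cong-≗ (λ l → trans (cong (entry A i l *_) (lookup-·ᵥ c u l)) (x∙yz≈y∙xz _ _ _)) ⟩
      ∑[ l < n ] (c * (entry A i l * lookup u l))
        ≡⟨ *-distribˡ-sum c (λ l → entry A i l * lookup u l) ⟨
      c * ∑[ l < n ] (entry A i l * lookup u l)
        ≡⟨ cong (c *_) (lookup-· A u i) ⟨
      c * lookup (A · u) i
        ≡⟨ lookup-·ᵥ c (A · u) i ⟨
      lookup (c ·ᵥ (A · u)) i ∎
      where open ≡-Reasoning

    ·-0ᵥ : ∀ (A : Mat n) → A · 0ᵥ ≡ 0ᵥ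
    ·-0ᵥ A = Vec-ext λ i →
      trans (lookup-· A 0ᵥ i) (trans (∑-zero λ l → trans (cong (entry A i l *_) (lookup-0ᵥ l)) (zeroʳ _)) (sym (lookup-0ᵥ i)))

    ·-lincomb : ∀ {k} (A : Mat n) (c : V k) bs → A · lincomb c bs ≡ lincomb c (Vec.map (A ·_) bs)
    ·-lincomb A []       []       = ·-0ᵥ A
    ·-lincomb A (c ∷ cs) (b ∷ bs) = trans (·-+ᵥ A _ _) (cong₂ _+ᵥ_ (·-·ᵥ A c b) (·-lincomb A cs bs))

    ⊗-· : ∀ (A C : Mat n) v → (A ⊗ C) · v ≡ A · (C · v)
    ⊗-· A C v = Vec-ext λ i → begin
      lookup ((A ⊗ C) · v) i                                           ≡⟨ lookup-· (A ⊗ C) v i ⟩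
      ∑[ j < n ] (entry (A ⊗ C) i j * lookup v j)                      ≡⟨ sum-cong-≗ (expand i) ⟩
      ∑[ j < n ] ∑[ l < n ] ((entry A i l * entry C l j) * lookup v j) ≡⟨ ∑-comm (λ j l → (entry A i l * entry C l j) * lookup v j) ⟩
      ∑[ l < n ] ∑[ j < n ] ((entry A i l * entry C l j) * lookup v j) ≡⟨ sum-cong-≗ (regroup i) ⟩
      ∑[ l < n ] (entry A i l * lookup (C · v) l)                      ≡⟨ lookup-· A (C · v) i ⟨
      lookup (A · (C · v)) i                                           ∎
      where
      open ≡-Reasoning
      expand : ∀ i j → entry (A ⊗ C) i j * lookup v j ≡ ∑[ l < n ] ((entry A i l * entry C l j) * lookup v j)
      expand i j = trans (cong (_* lookup v j) (entry-⊗ A C i j)) (*-distribʳ-sum (lookup v j) λ l → entry A i l * entry C l j)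
      regroup : ∀ i l → ∑[ j < n ] ((entry A i l * entry C l j) * lookup v j) ≡ entry A i l * lookup (C · v) l
      regroup i l = begin
        ∑[ j < n ] ((entry A i l * entry C l j) * lookup v j) ≡⟨ sum-cong-≗ (λ j → *-assoc (entry A i l) (entry C l j) (lookup v j)) ⟩
        ∑[ j < n ] (entry A i l * (entry C l j * lookup v j)) ≡⟨ *-distribˡ-sum (entry A i l) (λ j → entry C l j * lookup v j) ⟨
        entry A i l * ∑[ j < n ] (entry C l j * lookup v j)   ≡⟨ cong (entry A i l *_) (lookup-· C v l) ⟨
        entry A i l * lookup (C · v) l                        ∎

    ⊗-assoc : ∀ (A C D : Mat n) → (A ⊗ C) ⊗ D ≡ A ⊗ (C ⊗ D)
    ⊗-assoc A C D = ≡-by-columns λ j → begin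
      ((A ⊗ C) ⊗ D) · e j ≡⟨ ⊗-· (A ⊗ C) D (e j) ⟩
      (A ⊗ C) · (D · e j) ≡⟨ ⊗-· A C (D · e j) ⟩
      A · (C · (D · e j)) ≡⟨ cong (A ·_) (⊗-· C D (e j)) ⟨
      A · ((C ⊗ D) · e j) ≡⟨ ⊗-· A (C ⊗ D) (e j) ⟨
      (A ⊗ (C ⊗ D)) · e j ∎
      where open ≡-Reasoning

    Iₙ-· : ∀ (v : V n) → Iₙ · v ≡ v
    Iₙ-· v = Vec-ext λ i →
      trans (lookup-· Iₙ v i) (trans (sum-cong-≗ λ l → cong (_* lookup v l) (entry-Iₙ i l)) (∑-e* i (lookup v)))

    Iₙ-⊗ : ∀ (A : Mat n) → Iₙ ⊗ A ≡ A
    Iₙ-⊗ A = ≡-by-columns λ j → trans (⊗-· Iₙ A (e j)) (Iₙ-· (A · e j))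

    InB-injective : ∀ {b : Mat n} → InB b → ∀ {u v} → b · u ≡ b · v → u ≡ v
    InB-injective {b} (_ , c , _ , cb≡I) {u} {v} bu≡bv = begin
      u           ≡⟨ cancel u ⟨
      c · (b · u) ≡⟨ cong (c ·_) bu≡bv ⟩
      c · (b · v) ≡⟨ cancel v ⟩
      v           ∎
      where
      open ≡-Reasoning
      cancel : ∀ w → c · (b · w) ≡ w
      cancel w = trans (sym (⊗-· c b w)) (trans (cong (_· w) cb≡I) (Iₙ-· w))

    Iₙ-InB : InB Iₙ
    Iₙ-InB = (λ i j j<i → trans (entry-Iₙ i j) (lookup-e-≢ (Finₚ.<⇒≢ j<i ∘ sym))) , Iₙ , Iₙ-⊗ Iₙ , Iₙ-⊗ Iₙ

    ⊗-InB : ∀ {b c : Mat n} → InB b → InB c → InB (b ⊗ c)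
    ⊗-InB {b} {c} (b-upper , b⁻¹ , bb⁻¹ , b⁻¹b) (c-upper , c⁻¹ , cc⁻¹ , c⁻¹c) =
      upper , c⁻¹ ⊗ b⁻¹ , cancel b c b⁻¹ c⁻¹ cc⁻¹ bb⁻¹ , cancel c⁻¹ b⁻¹ c b b⁻¹b c⁻¹c
      where
      upper : ∀ r t → toℕ t ℕ.< toℕ r → entry (b ⊗ c) r t ≡ 0#
      upper r t t<r = trans (entry-⊗ b c r t) (∑-zero term≡0)
        where
        term≡0 : ∀ l → entry b r l * entry c l t ≡ 0#
        term≡0 l with toℕ l ℕₚ.<? toℕ r
        ... | yes l<r = trans (cong (_* entry c l t) (b-upper r l l<r)) (zeroˡ _)
        ... | no l≮r  = trans (cong (entry b r l *_) (c-upper l t (ℕₚ.<-≤-trans t<r (ℕₚ.≮⇒≥ l≮r)))) (zeroʳ _)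
      cancel : ∀ (A B A′ B′ : Mat n) → B ⊗ B′ ≡ Iₙ → A ⊗ A′ ≡ Iₙ → (A ⊗ B) ⊗ (B′ ⊗ A′) ≡ Iₙ
      cancel A B A′ B′ BB′≡I AA′≡I = begin
        (A ⊗ B) ⊗ (B′ ⊗ A′) ≡⟨ ⊗-assoc A B (B′ ⊗ A′) ⟩
        A ⊗ (B ⊗ (B′ ⊗ A′)) ≡⟨ cong (A ⊗_) (⊗-assoc B B′ A′) ⟨
        A ⊗ ((B ⊗ B′) ⊗ A′) ≡⟨ cong (λ M → A ⊗ (M ⊗ A′)) BB′≡I ⟩
        A ⊗ (Iₙ ⊗ A′)       ≡⟨ cong (A ⊗_) (Iₙ-⊗ A′) ⟩
        A ⊗ A′              ≡⟨ AA′≡I ⟩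
        Iₙ                  ∎
        where open ≡-Reasoning

  u+ᵥ-u≡0ᵥ : ∀ {k} (u : V k) → u +ᵥ ((- 1#) ·ᵥ u) ≡ 0ᵥ
  u+ᵥ-u≡0ᵥ u = Vec-ext λ t → begin
    lookup (u +ᵥ ((- 1#) ·ᵥ u)) t       ≡⟨ lookup-+ᵥ u ((- 1#) ·ᵥ u) t ⟩
    lookup u t + lookup ((- 1#) ·ᵥ u) t ≡⟨ cong (lookup u t +_) (trans (lookup-·ᵥ (- 1#) u t) (-1*x≈-x _)) ⟩
    lookup u t + - lookup u t           ≡⟨ -‿inverseʳ _ ⟩
    0#                                  ≡⟨ lookup-0ᵥ t ⟨
    lookup 0ᵥ t                         ∎
    where open ≡-Reasoning

  u-cw+cw≡u : ∀ {k} (u w : V k) c → (u +ᵥ ((- c) ·ᵥ w)) +ᵥ (c ·ᵥ w) ≡ u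
  u-cw+cw≡u u w c = Vec-ext λ t → begin
    lookup ((u +ᵥ ((- c) ·ᵥ w)) +ᵥ (c ·ᵥ w)) t
      ≡⟨ trans (lookup-+ᵥ (u +ᵥ ((- c) ·ᵥ w)) (c ·ᵥ w) t) (cong₂ _+_ (lookup-+ᵥ u ((- c) ·ᵥ w) t) (lookup-·ᵥ c w t)) ⟩
    (lookup u t + lookup ((- c) ·ᵥ w) t) + c * lookup w t
      ≡⟨ cong (λ a → (lookup u t + a) + c * lookup w t) (lookup-·ᵥ (- c) w t) ⟩
    (lookup u t + (- c) * lookup w t) + c * lookup w t
      ≡⟨ +-assoc _ _ _ ⟩
    lookup u t + ((- c) * lookup w t + c * lookup w t)
      ≡⟨ cong (lookup u t +_) (sym (distribʳ _ _ _)) ⟩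
    lookup u t + (- c + c) * lookup w t
      ≡⟨ cong (λ a → lookup u t + a * lookup w t) (-‿inverseˡ c) ⟩
    lookup u t + 0# * lookup w t
      ≡⟨ trans (cong (lookup u t +_) (zeroˡ _)) (+-identityʳ _) ⟩
    lookup u t ∎
    where open ≡-Reasoning

  u+v-u≡v : ∀ {k} (u v : V k) → (u +ᵥ v) +ᵥ ((- 1#) ·ᵥ u) ≡ v
  u+v-u≡v u v = Vec-ext λ t → begin
    lookup ((u +ᵥ v) +ᵥ ((- 1#) ·ᵥ u)) t
      ≡⟨ trans (lookup-+ᵥ (u +ᵥ v) ((- 1#) ·ᵥ u) t) (cong₂ _+_ (lookup-+ᵥ u v t) (lookup-·ᵥ (- 1#) u t)) ⟩
    (lookup u t + lookup v t) + - 1# * lookup u t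
      ≡⟨ cong₂ _+_ (+-comm _ _) (-1*x≈-x _) ⟩
    (lookup v t + lookup u t) + - lookup u t
      ≡⟨ +-assoc _ _ _ ⟩
    lookup v t + (lookup u t + - lookup u t)
      ≡⟨ trans (cong (lookup v t +_) (-‿inverseʳ _)) (+-identityʳ _) ⟩
    lookup v t ∎
    where open ≡-Reasoning

  module _ {n k : ℕ} where

    lincomb-+ᵥ : ∀ (c c′ : V k) (bs : Vec (V n) k) → lincomb (c +ᵥ c′) bs ≡ lincomb c bs +ᵥ lincomb c′ bs
    lincomb-+ᵥ c c′ bs = Vec-ext λ t → begin
      lookup (lincomb (c +ᵥ c′) bs) t
        ≡⟨ lookup-lincomb (c +ᵥ c′) bs t ⟩
      ∑[ s < k ] (lookup (c +ᵥ c′) s * b s t)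
        ≡⟨ sum-cong-≗ (λ s → trans (cong (_* b s t) (lookup-+ᵥ c c′ s)) (distribʳ _ _ _)) ⟩
      ∑[ s < k ] (lookup c s * b s t + lookup c′ s * b s t)
        ≡⟨ ∑-distrib-+ (λ s → lookup c s * b s t) (λ s → lookup c′ s * b s t) ⟩
      ∑[ s < k ] (lookup c s * b s t) + ∑[ s < k ] (lookup c′ s * b s t)
        ≡⟨ cong₂ _+_ (lookup-lincomb c bs t) (lookup-lincomb c′ bs t) ⟨
      lookup (lincomb c bs) t + lookup (lincomb c′ bs) t
        ≡⟨ lookup-+ᵥ (lincomb c bs) (lincomb c′ bs) t ⟨
      lookup (lincomb c bs +ᵥ lincomb c′ bs) t ∎
      where
      open ≡-Reasoning
      b : Fin k → Fin n → F
      b s = lookup (lookup bs s)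

    lincomb-·ᵥ : ∀ a (c : V k) (bs : Vec (V n) k) → lincomb (a ·ᵥ c) bs ≡ a ·ᵥ lincomb c bs
    lincomb-·ᵥ a c bs = Vec-ext λ t → begin
      lookup (lincomb (a ·ᵥ c) bs) t
        ≡⟨ lookup-lincomb (a ·ᵥ c) bs t ⟩
      ∑[ s < k ] (lookup (a ·ᵥ c) s * b s t)
        ≡⟨ sum-cong-≗ (λ s → trans (cong (_* b s t) (lookup-·ᵥ a c s)) (*-assoc _ _ _)) ⟩
      ∑[ s < k ] (a * (lookup c s * b s t))
        ≡⟨ *-distribˡ-sum a (λ s → lookup c s * b s t) ⟨
      a * ∑[ s < k ] (lookup c s * b s t)
        ≡⟨ cong (a *_) (lookup-lincomb c bs t) ⟨
      a * lookup (lincomb c bs) t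
        ≡⟨ lookup-·ᵥ a (lincomb c bs) t ⟨
      lookup (a ·ᵥ lincomb c bs) t ∎
      where
      open ≡-Reasoning
      b : Fin k → Fin n → F
      b s = lookup (lookup bs s)

    InSpan-+ᵥ : ∀ {bs : Vec (V n) k} {u v} → InSpan bs u → InSpan bs v → InSpan bs (u +ᵥ v)
    InSpan-+ᵥ {bs} (c , refl) (c′ , refl) = c +ᵥ c′ , lincomb-+ᵥ c c′ bs

    InSpan-·ᵥ : ∀ {bs : Vec (V n) k} a {u} → InSpan bs u → InSpan bs (a ·ᵥ u)
    InSpan-·ᵥ {bs} a (c , refl) = a ·ᵥ c , lincomb-·ᵥ a c bs

    LinIndep⇒lincomb-injective : ∀ {bs : Vec (V n) k} → LinIndep bs → ∀ {c c′} → lincomb c bs ≡ lincomb c′ bs → c ≡ c′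
    LinIndep⇒lincomb-injective {bs} indep {c} {c′} eq = Vec-ext λ s → x∙y⁻¹≈ε⇒x≈y _ _ (begin
      lookup c s + - lookup c′ s  ≡⟨ cong (lookup c s +_) (trans (sym (-1*x≈-x _)) (sym (lookup-·ᵥ (- 1#) c′ s))) ⟩
      lookup c s + lookup (-c′) s ≡⟨ lookup-+ᵥ c -c′ s ⟨
      lookup (c +ᵥ -c′) s         ≡⟨ indep (c +ᵥ -c′) difference≡0 s ⟩
      0#                          ∎)
      where
      open ≡-Reasoning
      -c′ = (- 1#) ·ᵥ c′
      difference≡0 : lincomb (c +ᵥ -c′) bs ≡ 0ᵥ
      difference≡0 = begin
        lincomb (c +ᵥ -c′) bs                      ≡⟨ lincomb-+ᵥ c -c′ bs ⟩
        lincomb c bs +ᵥ lincomb -c′ bs             ≡⟨ cong₂ _+ᵥ_ eq (lincomb-·ᵥ (- 1#) c′ bs) ⟩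
        lincomb c′ bs +ᵥ ((- 1#) ·ᵥ lincomb c′ bs) ≡⟨ u+ᵥ-u≡0ᵥ (lincomb c′ bs) ⟩
        0ᵥ                                         ∎

  ∈-vecsL : ∀ {k} (v : V k) → v ∈ vecsL k
  ∈-vecsL []      = here refl
  ∈-vecsL (a ∷ v) = subst (_ ∈_) (sym (concatMap-map≡cartesianProductWith _∷_ elems (vecsL _)))
    (∈-cartesianProductWith⁺ _∷_ (complete a) (∈-vecsL v))

  vecsL-unique : ∀ k → Unique (vecsL k)
  vecsL-unique ℕ.zero    = [] ∷ []
  vecsL-unique (ℕ.suc k) = subst Unique (sym (concatMap-map≡cartesianProductWith _∷_ elems (vecsL k)))
    (cartesianProductWith⁺ _∷_ Vecₚ.∷-injective unique (vecsL-unique k))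

  length-vecsL : ∀ k → length (vecsL k) ≡ q ℕ.^ k
  length-vecsL ℕ.zero    = refl
  length-vecsL (ℕ.suc k) = begin
    length (vecsL (ℕ.suc k))
      ≡⟨ cong length (concatMap-map≡cartesianProductWith _∷_ elems (vecsL k)) ⟩
    length (List.cartesianProductWith _∷_ elems (vecsL k))
      ≡⟨ length-cartesianProductWith _∷_ elems (vecsL k) ⟩
    q ℕ.* length (vecsL k)
      ≡⟨ cong (q ℕ.*_) (length-vecsL k) ⟩
    q ℕ.* q ℕ.^ k ∎
    where open ≡-Reasoning

  InSpan-card : ∀ {n k} (bs : Vec (V n) k) → LinIndep bs → HasCard (InSpan bs) (q ℕ.^ k)
  InSpan-card {k = k} bs indep =
    List.map (λ c → lincomb c bs) (vecsL k) ,
    trans (Listₚ.length-map _ (vecsL k)) (length-vecsL k) ,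
    Uniqueₚ.map⁺ (LinIndep⇒lincomb-injective indep) (vecsL-unique k) ,
    λ v → (λ v∈ → let c , _ , v≡ = ∈-map⁻ (λ c → lincomb c bs) v∈ in c , sym v≡) ,
          (λ { (c , refl) → ∈-map⁺ (λ c → lincomb c bs) (∈-vecsL c) })

  module _ {n : ℕ} where

    lookup-vecs-injective : ∀ {i j} → lookup (vecs n) i ≡ lookup (vecs n) j → i ≡ j
    lookup-vecs-injective {i} {j} eq = Unique⇒lookup-injective (vecsL-unique n)
      (trans (sym (lookup-fromList (vecsL n) i)) (trans eq (lookup-fromList (vecsL n) j)))

    lookup-vecs-surjective : ∀ v → ∃[ i ] lookup (vecs n) i ≡ v
    lookup-vecs-surjective v = Any.index v∈ , trans (lookup-fromList (vecsL n) _) (sym (lookup-index v∈))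
      where v∈ = ∈-vecsL v

    subsetOf : (V n → Bool) → Subset n
    subsetOf P = mkSubset (Vec.map P (vecs n))

    ∈-subsetOf⁻ : ∀ P {v} → v ∈ₛ subsetOf P → P v ≡ true
    ∈-subsetOf⁻ P (i , refl , bit) = trans (sym (lookup-map i P (vecs n))) bit

    ∈-subsetOf⁺ : ∀ P {v} → P v ≡ true → v ∈ₛ subsetOf P
    ∈-subsetOf⁺ P {v} Pv with lookup-vecs-surjective v
    ... | i , refl = i , refl , trans (lookup-map i P (vecs n)) Pv

    Subset-ext : ∀ {U U′ : Subset n} → (∀ v → v ∈ₛ U → v ∈ₛ U′) → (∀ v → v ∈ₛ U′ → v ∈ₛ U) → U ≡ U′
    Subset-ext {mkSubset bs} {mkSubset bs′} U⊆U′ U′⊆U = cong mkSubset (Vec-ext same-bit)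
      where
      bit-transfer : ∀ {cs cs′} → (∀ v → v ∈ₛ mkSubset cs → v ∈ₛ mkSubset cs′) →
                     ∀ i → lookup cs i ≡ true → lookup cs′ i ≡ true
      bit-transfer ⊆′ i bit with ⊆′ _ (i , refl , bit)
      ... | i′ , eq , bit′ with lookup-vecs-injective eq
      ... | refl = bit′
      same-bit : ∀ i → lookup bs i ≡ lookup bs′ i
      same-bit i with lookup bs i in b≡ | lookup bs′ i in b′≡
      ... | true  | true  = refl
      ... | false | false = refl
      ... | true  | false = contradiction (trans (sym (bit-transfer {bs} {bs′} U⊆U′ i b≡)) b′≡) λ ()
      ... | false | true  = contradiction (trans (sym (bit-transfer {bs′} {bs} U′⊆U i b′≡)) b≡) λ ()

  _≟V_ : ∀ {k} → DecidableEquality (V k)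
  _≟V_ = ≡-dec _≟F_

  module _ {n : ℕ} where

    -- InE x k u : u ∈ E^x_k = ⟨e (x 0), …, e (x (k-1))⟩, positions being 0-based.
    record InE (x : Fin n → Fin n) (k : ℕ) (u : V n) : Set where
      constructor vanishing
      field vanishes : ∀ t → k ≤ toℕ t → lookup u (x t) ≡ 0#

    open InE public

    InE? : ∀ x k u → Dec (InE x k u)
    InE? x k u = map′ vanishing vanishes (all? λ t → (k ℕ.≤? toℕ t) →-dec (lookup u (x t) ≟F 0#))

    InE-mono : ∀ {x k k′ u} → k ≤ k′ → InE x k u → InE x k′ u
    InE-mono k≤k′ u∈E .vanishes t k′≤t = vanishes u∈E t (ℕₚ.≤-trans k≤k′ k′≤t)

    InE-cong : ∀ {x y k u} → x ≗ y → InE x k u → InE y k u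
    InE-cong {u = u} x≗y u∈E .vanishes t k≤t = trans (cong (lookup u) (sym (x≗y t))) (vanishes u∈E t k≤t)

    InBE : Mat n → (Fin n → Fin n) → ℕ → V n → Set
    InBE b x k v = ∃[ u ] InE x k u × b · u ≡ v

    InBE? : ∀ b x k v → Dec (InBE b x k v)
    InBE? b x k v = map′ Any.satisfied (λ { (u , u∈E , bu≡v) → lose (∈-vecsL u) (u∈E , bu≡v) })
      (Any.any? (λ u → InE? x k u ×-dec (b · u) ≟V v) (vecsL n))

    flagLevel : Mat n → (Fin n → Fin n) → Fin (ℕ.suc n) → Subset n
    flagLevel b x k = subsetOf λ v → does (InBE? b x (toℕ k) v)

    flag : Mat n → (Fin n → Fin n) → Flag n
    flag b x = tabulate (flagLevel b x)

    ∈-flag⁻ : ∀ {b x} k {v} → v ∈ₛ lookup (flag b x) k → InBE b x (toℕ k) v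
    ∈-flag⁻ {b} {x} k {v} v∈ = does≡true⇒ (InBE? b x (toℕ k) v)
      (∈-subsetOf⁻ (λ v → does (InBE? b x (toℕ k) v)) (subst (v ∈ₛ_) (lookup∘tabulate (flagLevel b x) k) v∈))

    ∈-flag⁺ : ∀ {b x} k {v} → InBE b x (toℕ k) v → v ∈ₛ lookup (flag b x) k
    ∈-flag⁺ {b} {x} k {v} v∈ = subst (v ∈ₛ_) (sym (lookup∘tabulate (flagLevel b x) k))
      (∈-subsetOf⁺ (λ v → does (InBE? b x (toℕ k) v)) (dec-true (InBE? b x (toℕ k) v) v∈))

    flag-level-≡ : ∀ {b x b′ x′} k → (∀ v → InBE b x (toℕ k) v → InBE b′ x′ (toℕ k) v) →
                   (∀ v → InBE b′ x′ (toℕ k) v → InBE b x (toℕ k) v) → lookup (flag b x) k ≡ lookup (flag b′ x′) k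
    flag-level-≡ {b} {x} {b′} {x′} k ⊆ ⊇ = Subset-ext
      (λ v → ∈-flag⁺ {b′} {x′} k ∘ ⊆ v ∘ ∈-flag⁻ {b} {x} k) (λ v → ∈-flag⁺ {b} {x} k ∘ ⊇ v ∘ ∈-flag⁻ {b′} {x′} k)

    flag-cong : ∀ b {x y} → x ≗ y → flag b x ≡ flag b y
    flag-cong b x≗y = Vec-ext λ k → flag-level-≡ k
      (λ { v (u , u∈E , bu≡v) → u , InE-cong x≗y u∈E , bu≡v })
      (λ { v (u , u∈E , bu≡v) → u , InE-cong (sym ∘ x≗y) u∈E , bu≡v })

    lookup-lincomb-e : ∀ {k} (h : Fin k → Fin n) c m →
                       lookup (lincomb c (tabulate (e ∘ h))) m ≡ ∑[ s < k ] (lookup c s * lookup (e (h s)) m)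
    lookup-lincomb-e h c m = trans (lookup-lincomb c _ m)
      (sum-cong-≗ λ s → cong (λ w → lookup c s * lookup w m) (lookup∘tabulate (e ∘ h) s))

    lookup-lincomb-e-miss : ∀ {k} (h : Fin k → Fin n) c m → (∀ s → h s ≢ m) →
                            lookup (lincomb c (tabulate (e ∘ h))) m ≡ 0#
    lookup-lincomb-e-miss h c m h≢m = trans (lookup-lincomb-e h c m)
      (∑-zero λ s → trans (cong (lookup c s *_) (lookup-e-≢ (h≢m s))) (zeroʳ _))

    lookup-lincomb-e-hit : ∀ {k} {h : Fin k → Fin n} → Injective _≡_ _≡_ h → ∀ c s →
                           lookup (lincomb c (tabulate (e ∘ h))) (h s) ≡ lookup c s
    lookup-lincomb-e-hit {h = h} h-inj c s = begin
      lookup (lincomb c (tabulate (e ∘ h))) (h s)       ≡⟨ lookup-lincomb-e h c (h s) ⟩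
      ∑[ s′ < _ ] (lookup c s′ * lookup (e (h s′)) (h s)) ≡⟨ ∑-single _ s off-diagonal ⟩
      lookup c s * lookup (e (h s)) (h s)               ≡⟨ trans (cong (lookup c s *_) (lookup-e-≡ (h s))) (*-identityʳ _) ⟩
      lookup c s                                        ∎
      where
      open ≡-Reasoning
      off-diagonal : ∀ s′ → s′ ≢ s → lookup c s′ * lookup (e (h s′)) (h s) ≡ 0#
      off-diagonal s′ s′≢s = trans (cong (lookup c s′ *_) (lookup-e-≢ (s′≢s ∘ h-inj))) (zeroʳ _)

    module _ {x : Fin n → Fin n} (x-perm : IsPermutation x) (k : Fin (ℕ.suc n)) where
      open IsPermutation x-perm

      private
        ι : Fin (toℕ k) → Fin n
        ι s = inject≤ s (toℕ≤pred[n] k)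

        toℕ-ι : ∀ s → toℕ (ι s) ≡ toℕ s
        toℕ-ι s = toℕ-inject≤ s (toℕ≤pred[n] k)

        x∘ι≡⇒<k : ∀ {s t} → x (ι s) ≡ x t → toℕ t ℕ.< toℕ k
        x∘ι≡⇒<k {s} eq = subst (ℕ._< toℕ k) (trans (sym (toℕ-ι s)) (cong toℕ (injective eq))) (toℕ<n s)

        x∘ι-injective : Injective _≡_ _≡_ (x ∘ ι)
        x∘ι-injective eq = toℕ-injective (trans (sym (toℕ-ι _)) (trans (cong toℕ (injective eq)) (toℕ-ι _)))

      InSpan-basisW⇒InE : ∀ {u} → InSpan (basisW x k) u → InE x (toℕ k) u
      InSpan-basisW⇒InE (c , refl) .vanishes t k≤t =
        lookup-lincomb-e-miss (x ∘ ι) c (x t) λ s eq → ℕₚ.<⇒≱ (x∘ι≡⇒<k eq) k≤t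

      InE⇒InSpan-basisW : ∀ {u} → InE x (toℕ k) u → InSpan (basisW x k) u
      InE⇒InSpan-basisW {u} u∈E = c , Vec-ext coordinate
        where
        c = tabulate λ s → lookup u (x (ι s))
        coordinate : ∀ m → lookup (lincomb c (basisW x k)) m ≡ lookup u m
        coordinate m with toℕ (from m) ℕ.<? toℕ k
        ... | yes from<k = subst (λ m → lookup (lincomb c (basisW x k)) m ≡ lookup u m) xιs≡m
                                (trans (lookup-lincomb-e-hit x∘ι-injective c s) (lookup∘tabulate _ s))
          where
          s = fromℕ< from<k
          xιs≡m : x (ι s) ≡ m
          xιs≡m = trans (cong x (toℕ-injective (trans (toℕ-ι s) (toℕ-fromℕ< from<k)))) (strictlyInverseˡ m)
        ... | no from≮k = begin
          lookup (lincomb c (basisW x k)) m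
            ≡⟨ lookup-lincomb-e-miss (x ∘ ι) c m (λ s eq → from≮k (x∘ι≡⇒<k (trans eq (sym (strictlyInverseˡ m))))) ⟩
          0#
            ≡⟨ vanishes u∈E (from m) (ℕₚ.≮⇒≥ from≮k) ⟨
          lookup u (x (from m))
            ≡⟨ cong (lookup u) (strictlyInverseˡ m) ⟩
          lookup u m ∎
          where open ≡-Reasoning

      levelBasis : Mat n → Vec (V n) (toℕ k)
      levelBasis b = Vec.map (b ·_) (basisW x k)

      InBE⇒InSpan-levelBasis : ∀ {b v} → InBE b x (toℕ k) v → InSpan (levelBasis b) v
      InBE⇒InSpan-levelBasis {b} (u , u∈E , refl) with InE⇒InSpan-basisW {u} u∈E
      ... | c , refl = c , sym (·-lincomb b c (basisW x k))

      InSpan-levelBasis⇒InBE : ∀ {b v} → InSpan (levelBasis b) v → InBE b x (toℕ k) v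
      InSpan-levelBasis⇒InBE {b} (c , refl) =
        lincomb c (basisW x k) , InSpan-basisW⇒InE (c , refl) , ·-lincomb b c (basisW x k)

      levelBasis-independent : ∀ {b} → InB b → LinIndep (levelBasis b)
      levelBasis-independent {b} b∈B c lincomb≡0 s = begin
        lookup c s                                ≡⟨ lookup-lincomb-e-hit x∘ι-injective c s ⟨
        lookup (lincomb c (basisW x k)) (x (ι s)) ≡⟨ cong (λ w → lookup w (x (ι s))) lincomb-basisW≡0 ⟩
        lookup 0ᵥ (x (ι s))                       ≡⟨ lookup-0ᵥ (x (ι s)) ⟩
        0#                                        ∎
        where
        open ≡-Reasoning
        lincomb-basisW≡0 : lincomb c (basisW x k) ≡ 0ᵥ
        lincomb-basisW≡0 = InB-injective b∈B (trans (·-lincomb b c (basisW x k)) (trans lincomb≡0 (sym (·-0ᵥ b))))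

      InBE-card : ∀ {b} → InB b → HasCard (InBE b x (toℕ k)) (q ℕ.^ toℕ k)
      InBE-card b∈B = HasCard-cong (λ _ → InSpan-levelBasis⇒InBE) (λ _ → InBE⇒InSpan-levelBasis)
                                   (InSpan-card _ (levelBasis-independent b∈B))

    flag-isFlag : ∀ {b x} → InB b → IsPermutation x → IsFlag (flag b x)
    flag-isFlag {b} {x} b∈B x-perm =
      (λ k → levelBasis x-perm k b , levelBasis-independent x-perm k b∈B , λ v →
               InBE⇒InSpan-levelBasis x-perm k ∘ ∈-flag⁻ k , ∈-flag⁺ k ∘ InSpan-levelBasis⇒InBE x-perm k) ,
      λ { k v v∈ → let u , u∈E , bu≡v = ∈-flag⁻ (inject₁ k) v∈ in
                   ∈-flag⁺ (suc k) (u , InE-mono (ℕₚ.≤-trans (ℕₚ.≤-reflexive (toℕ-inject₁ k)) (ℕₚ.n≤1+n _)) u∈E , bu≡v) }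

    InBE-Iₙ-id⇒InE : ∀ {k v} → InBE Iₙ id k v → InE id k v
    InBE-Iₙ-id⇒InE {k} (u , u∈E , refl) = subst (InE id k) (sym (Iₙ-· u)) u∈E

    InE-card : ∀ (k : Fin (ℕ.suc n)) → HasCard (InE id (toℕ k)) (q ℕ.^ toℕ k)
    InE-card k = HasCard-cong (λ _ → InBE-Iₙ-id⇒InE) (λ v v∈E → v , v∈E , Iₙ-· v) (InBE-card id-isPermutation k Iₙ-InB)

    flag-Iₙ-id-isStandard : IsStandardFlag (flag Iₙ id)
    flag-Iₙ-id-isStandard k v =
      InE⇒InSpan-basisW id-isPermutation k ∘ InBE-Iₙ-id⇒InE ∘ ∈-flag⁻ k ,
      λ v∈span → ∈-flag⁺ k (v , InSpan-basisW⇒InE id-isPermutation k v∈span , Iₙ-· v)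

    isStandard⇒≡flag-Iₙ-id : ∀ {Fl} → IsStandardFlag Fl → Fl ≡ flag Iₙ id
    isStandard⇒≡flag-Iₙ-id std = Vec-ext λ k → Subset-ext
      (λ v v∈ → ∈-flag⁺ k (v , InSpan-basisW⇒InE id-isPermutation k (proj₁ (std k v) v∈) , Iₙ-· v))
      (λ v v∈ → proj₂ (std k v) (proj₁ (flag-Iₙ-id-isStandard k v) v∈))

    InSchubertCell⇒≡flag : ∀ {w Fl} → IsPermutation w → InSchubertCell w Fl → ∃[ b ] InB b × Fl ≡ flag b w
    InSchubertCell⇒≡flag {w} w-perm (b , b∈B , levels) = b , b∈B , Vec-ext λ k → Subset-ext
      (λ v v∈ → let u , u∈span , bu≡v = proj₁ (levels k v) v∈ in
                ∈-flag⁺ k (u , InSpan-basisW⇒InE w-perm k u∈span , bu≡v))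
      (λ v v∈ → let u , u∈E , bu≡v = ∈-flag⁻ k v∈ in
                proj₂ (levels k v) (u , InE⇒InSpan-basisW w-perm k u∈E , bu≡v))

    flag-InSchubertCell : ∀ {w b} → IsPermutation w → InB b → InSchubertCell w (flag b w)
    flag-InSchubertCell w-perm b∈B = _ , b∈B , λ k v →
      (λ v∈ → let u , u∈E , bu≡v = ∈-flag⁻ k v∈ in u , InE⇒InSpan-basisW w-perm k u∈E , bu≡v) ,
      (λ { (u , u∈span , bu≡v) → ∈-flag⁺ k (u , InSpan-basisW⇒InE w-perm k u∈span , bu≡v) })

  2≤q : 2 ≤ q
  2≤q = HasCard-≤ (HasCard-∈ {xs = 0# ∷ 1# ∷ []} ((0≢1 ∷ []) ∷ [] ∷ [])) (HasCard-∈ unique) id id (λ x _ → complete x)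

  q^n<q^1+n : ∀ m → q ℕ.^ m ℕ.< q ℕ.^ ℕ.suc m
  q^n<q^1+n m = ℕₚ.^-monoʳ-< q 2≤q (ℕₚ.n<1+n m)

  module _ {n : ℕ} {b : Mat n} (b∈B : InB b) where

    private
      upper : ∀ i j → j < i → entry b i j ≡ 0#
      upper = proj₁ b∈B

    -- If b had a zero at (m, m), it would map E_{m+1} injectively into E_m.
    InB⇒diagonal≢0 : ∀ m → entry b m m ≢ 0#
    InB⇒diagonal≢0 m bmm≡0 = ℕₚ.<⇒≱ (q^n<q^1+n (toℕ m))
      (subst (λ j → q ℕ.^ ℕ.suc (toℕ m) ≤ q ℕ.^ j) (toℕ-inject₁ m)
        (HasCard-≤ (InE-card (suc m)) (InE-card (inject₁ m)) (b ·_) (InB-injective b∈B) maps))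
      where
      maps : ∀ v → InE id (ℕ.suc (toℕ m)) v → InE id (toℕ (inject₁ m)) (b · v)
      maps v v∈E .vanishes t m≤t = trans (lookup-· b v t) (∑-zero term≡0)
        where
        m≤t′ : toℕ m ≤ toℕ t
        m≤t′ = subst (_≤ toℕ t) (toℕ-inject₁ m) m≤t
        below-diagonal : ∀ {l} → ¬ l < t → l ≢ m → entry b t l * lookup v l ≡ 0#
        below-diagonal {l} l≮t l≢m = trans (cong (entry b t l *_)
          (vanishes v∈E l (Finₚ.≤∧≢⇒< (ℕₚ.≤-trans m≤t′ (ℕₚ.≮⇒≥ l≮t)) (l≢m ∘ sym)))) (zeroʳ _)
        term≡0 : ∀ l → entry b t l * lookup v l ≡ 0#
        term≡0 l with <-cmp l t | l ≟ m
        ... | tri< l<t _ _  | _        = trans (cong (_* lookup v l) (upper t l l<t)) (zeroˡ _)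
        ... | tri≈ _ refl _ | yes refl = trans (cong (_* lookup v l) bmm≡0) (zeroˡ _)
        ... | tri> _ _ t<l  | yes refl = contradiction m≤t′ (ℕₚ.<⇒≱ t<l)
        ... | tri≈ l≮t _ _  | no l≢m   = below-diagonal l≮t l≢m
        ... | tri> l≮t _ _  | no l≢m   = below-diagonal l≮t l≢m

    InB-reflects-InE-id : ∀ j v → InE id j (b · v) → InE id j v
    InB-reflects-InE-id j v bv∈E = vanishing (WF.All.wfRec >-wellFounded _ (λ t → j ≤ toℕ t → lookup v t ≡ 0#) step)
      where
      step : ∀ t → (∀ {s} → t < s → j ≤ toℕ s → lookup v s ≡ 0#) → j ≤ toℕ t → lookup v t ≡ 0#
      step t later j≤t = x*y≡0⇒y≡0 (InB⇒diagonal≢0 t) (begin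
        entry b t t * lookup v t              ≡⟨ ∑-single _ t off-diagonal ⟨
        ∑[ l < n ] (entry b t l * lookup v l) ≡⟨ lookup-· b v t ⟨
        lookup (b · v) t                      ≡⟨ vanishes bv∈E t j≤t ⟩
        0#                                    ∎)
        where
        open ≡-Reasoning
        off-diagonal : ∀ l → l ≢ t → entry b t l * lookup v l ≡ 0#
        off-diagonal l l≢t with <-cmp l t
        ... | tri< l<t _ _ = trans (cong (_* lookup v l) (upper t l l<t)) (zeroˡ _)
        ... | tri≈ _ l≡t _ = contradiction l≡t l≢t
        ... | tri> _ _ t<l = trans (cong (entry b t l *_) (later t<l (ℕₚ.≤-trans j≤t (ℕₚ.<⇒≤ t<l)))) (zeroʳ _)

  module _ {n : ℕ} where

    _⊆_+E_ : (V n → Set) → (V n → Set) → ℕ → Set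
    A ⊆ B +E j = ∀ v → A v → ∃[ v₁ ] ∃[ v₂ ] B v₁ × InE id j v₂ × v ≡ v₁ +ᵥ v₂

    ⊆+E-mono : ∀ {A A′ B B′ : V n → Set} {j} → (∀ v → A′ v → A v) → (∀ v → B v → B′ v) →
               A ⊆ B +E j → A′ ⊆ B′ +E j
    ⊆+E-mono A′⊆A B⊆B′ split v v∈A′ =
      let v₁ , v₂ , v₁∈B , v₂∈E , v≡ = split v (A′⊆A v v∈A′) in v₁ , v₂ , B⊆B′ v₁ v₁∈B , v₂∈E , v≡

    module _ {b : Mat n} {x : Fin n → Fin n} (b∈B : InB b) (x-perm : IsPermutation x) (t : Fin n) (j : ℕ) where
      open IsPermutation x-perm

      private
        e-xt∈E : InE x (ℕ.suc (toℕ t)) (e (x t))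
        e-xt∈E .vanishes r t<r = lookup-e-≢ (Finₚ.<⇒≢ t<r ∘ injective)

      -- Level t+1 of b·E^x is level t plus the column b e_{x t}, which lies in E_{x t + 1}; so
      -- x t < j iff level t+1 ⊆ level t + E_j, and the flag b·E^x determines x.
      x<j⇒splits : toℕ (x t) ℕ.< j → InBE b x (ℕ.suc (toℕ t)) ⊆ InBE b x (toℕ t) +E j
      x<j⇒splits xt<j v (u , u∈E , refl) =
        b · u′ , c ·ᵥ (b · e (x t)) , (u′ , u′∈E , refl) , column∈E , bu≡
        where
        c = lookup u (x t)
        u′ = u +ᵥ ((- c) ·ᵥ e (x t))
        lookup-u′ : ∀ m → lookup u′ m ≡ lookup u m + (- c) * lookup (e (x t)) m
        lookup-u′ m = trans (lookup-+ᵥ u _ m) (cong (lookup u m +_) (lookup-·ᵥ (- c) (e (x t)) m))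
        u′∈E : InE x (toℕ t) u′
        u′∈E .vanishes r t≤r with r ≟ t
        ... | yes refl = trans (lookup-u′ (x t)) (trans (cong (λ a → c + (- c) * a) (lookup-e-≡ (x t)))
                           (trans (cong (c +_) (*-identityʳ _)) (-‿inverseʳ c)))
        ... | no r≢t = trans (lookup-u′ (x r)) (trans (cong₂ _+_ (vanishes u∈E r (Finₚ.≤∧≢⇒< t≤r (r≢t ∘ sym)))
                           (trans (cong ((- c) *_) (lookup-e-≢ (r≢t ∘ sym ∘ injective))) (zeroʳ _))) (+-identityʳ 0#))
        column∈E : InE id j (c ·ᵥ (b · e (x t)))
        column∈E .vanishes r j≤r = trans (lookup-·ᵥ c (b · e (x t)) r) (trans (cong (c *_)
          (trans (lookup-·-e b r (x t)) (proj₁ b∈B r (x t) (ℕₚ.<-≤-trans xt<j j≤r)))) (zeroʳ c))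
        bu≡ : b · u ≡ (b · u′) +ᵥ (c ·ᵥ (b · e (x t)))
        bu≡ = begin
          b · u                            ≡⟨ cong (b ·_) (u-cw+cw≡u u (e (x t)) c) ⟨
          b · (u′ +ᵥ (c ·ᵥ e (x t)))       ≡⟨ ·-+ᵥ b u′ _ ⟩
          (b · u′) +ᵥ (b · (c ·ᵥ e (x t))) ≡⟨ cong ((b · u′) +ᵥ_) (·-·ᵥ b c (e (x t))) ⟩
          (b · u′) +ᵥ (c ·ᵥ (b · e (x t))) ∎
          where open ≡-Reasoning

      splits⇒x<j : InBE b x (ℕ.suc (toℕ t)) ⊆ InBE b x (toℕ t) +E j → toℕ (x t) ℕ.< j
      splits⇒x<j split with toℕ (x t) ℕ.<? j
      ... | yes xt<j = xt<j
      ... | no xt≮j with split (b · e (x t)) (e (x t) , e-xt∈E , refl)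
      ...   | _ , v₂ , (u₁ , u₁∈E , refl) , v₂∈E , be≡ = contradiction 1≡0 (0≢1 ∘ sym)
        where
        w = e (x t) +ᵥ ((- 1#) ·ᵥ u₁)
        bw≡v₂ : b · w ≡ v₂
        bw≡v₂ = begin
          b · w                                    ≡⟨ ·-+ᵥ b (e (x t)) _ ⟩
          (b · e (x t)) +ᵥ (b · ((- 1#) ·ᵥ u₁))    ≡⟨ cong₂ _+ᵥ_ be≡ (·-·ᵥ b (- 1#) u₁) ⟩
          ((b · u₁) +ᵥ v₂) +ᵥ ((- 1#) ·ᵥ (b · u₁)) ≡⟨ u+v-u≡v (b · u₁) v₂ ⟩
          v₂                                       ∎
          where open ≡-Reasoning
        1≡0 : 1# ≡ 0#
        1≡0 = begin
          1#
            ≡⟨ trans (cong (1# +_) (zeroʳ (- 1#))) (+-identityʳ 1#) ⟨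
          1# + - 1# * 0#
            ≡⟨ cong₂ (λ a z → a + - 1# * z) (lookup-e-≡ (x t)) (vanishes u₁∈E t ℕₚ.≤-refl) ⟨
          lookup (e (x t)) (x t) + - 1# * lookup u₁ (x t)
            ≡⟨ cong (lookup (e (x t)) (x t) +_) (lookup-·ᵥ (- 1#) u₁ (x t)) ⟨
          lookup (e (x t)) (x t) + lookup ((- 1#) ·ᵥ u₁) (x t)
            ≡⟨ lookup-+ᵥ (e (x t)) _ (x t) ⟨
          lookup w (x t)
            ≡⟨ vanishes (InB-reflects-InE-id b∈B j w (subst (InE id j) (sym bw≡v₂) v₂∈E)) (x t) (ℕₚ.≮⇒≥ xt≮j) ⟩
          0# ∎
          where open ≡-Reasoning

    flag-≡⇒InBE⊆ : ∀ {b b′ : Mat n} {x y} → flag b x ≡ flag b′ y → ∀ k v → InBE b x (toℕ k) v → InBE b′ y (toℕ k) v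
    flag-≡⇒InBE⊆ {b} {b′} {x} {y} flag≡ k v v∈ =
      ∈-flag⁻ {b = b′} {y} k (subst (λ Fl → v ∈ₛ lookup Fl k) flag≡ (∈-flag⁺ {b = b} {x} k v∈))

    flag-≡⇒<-transfer : ∀ {b b′ : Mat n} {x y} → InB b → InB b′ → IsPermutation x → IsPermutation y → flag b x ≡ flag b′ y →
                        ∀ t {j} → toℕ (x t) ℕ.< j → toℕ (y t) ℕ.< j
    flag-≡⇒<-transfer {b} {b′} {x} {y} b∈B b′∈B x-perm y-perm flag≡ t {j} xt<j =
      splits⇒x<j {b = b′} {y} b′∈B y-perm t j
        (⊆+E-mono (flag-≡⇒InBE⊆ (sym flag≡) (suc t)) level-t⊆ (x<j⇒splits {b = b} {x} b∈B x-perm t j xt<j))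
      where
      level-t⊆ : ∀ v → InBE b x (toℕ t) v → InBE b′ y (toℕ t) v
      level-t⊆ v v∈ = subst (λ k → InBE b′ y k v) (toℕ-inject₁ t)
        (flag-≡⇒InBE⊆ flag≡ (inject₁ t) v (subst (λ k → InBE b x k v) (sym (toℕ-inject₁ t)) v∈))

    flag-injective : ∀ {b b′ : Mat n} {x y} → InB b → InB b′ → IsPermutation x → IsPermutation y →
                     flag b x ≡ flag b′ y → x ≗ y
    flag-injective b∈B b′∈B x-perm y-perm flag≡ t = toℕ-injective (ℕₚ.≤-antisym
      (ℕₚ.≤-pred (flag-≡⇒<-transfer b′∈B b∈B y-perm x-perm (sym flag≡) t (ℕₚ.n<1+n _)))
      (ℕₚ.≤-pred (flag-≡⇒<-transfer b∈B b′∈B x-perm y-perm flag≡ t (ℕₚ.n<1+n _))))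

  module _ {n : ℕ} {y : Fin n → Fin n} where

    InE-suc⁻ : ∀ {k u} t → toℕ t ≡ k → InE y k u → InE y (ℕ.suc k) u × lookup u (y t) ≡ 0#
    InE-suc⁻ {k} t refl u∈E = InE-mono (ℕₚ.n≤1+n k) u∈E , vanishes u∈E t ℕₚ.≤-refl

    InE-suc⁺ : ∀ {k u} t → toℕ t ≡ k → InE y (ℕ.suc k) u → lookup u (y t) ≡ 0# → InE y k u
    InE-suc⁺ t refl u∈E uyt≡0 .vanishes t′ t≤t′ with t′ ≟ t
    ... | yes refl = uyt≡0
    ... | no t′≢t  = vanishes u∈E t′ (Finₚ.≤∧≢⇒< t≤t′ (t′≢t ∘ sym))

  module _ {m : ℕ} (i : Fin m) where
    open Letter i

    private
      toℕ-l : toℕ l ≡ toℕ i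
      toℕ-l = toℕ-inject₁ i

    InE-∘σ⁻ : ∀ {x k u} → k ≢ toℕ r → InE (x ∘ σ) k u → InE x k u
    InE-∘σ⁻ {x} {k} {u} k≢r u∈E .vanishes t k≤t with t ≟ l | t ≟ r
    ... | yes refl | _        = subst (λ s → lookup u (x s) ≡ 0#) σ-r (vanishes u∈E r (ℕₚ.≤-trans k≤t (ℕₚ.<⇒≤ l<r)))
    ... | no _     | yes refl = subst (λ s → lookup u (x s) ≡ 0#) σ-l
                                  (vanishes u∈E l (subst (k ≤_) (sym toℕ-l) (ℕₚ.≤-pred (ℕₚ.≤∧≢⇒< k≤t k≢r))))
    ... | no t≢l   | no t≢r   = subst (λ s → lookup u (x s) ≡ 0#) (σ-other t≢l t≢r) (vanishes u∈E t k≤t)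

    InE-∘σ⁺ : ∀ {x k u} → k ≢ toℕ r → InE x k u → InE (x ∘ σ) k u
    InE-∘σ⁺ {x} k≢r u∈E = InE-∘σ⁻ k≢r (InE-cong (cong x ∘ sym ∘ σ-involutive) u∈E)

    flag-∘σ-level : ∀ {b : Mat (ℕ.suc m)} {x} (k : Fin (ℕ.suc (ℕ.suc m))) → toℕ k ≢ toℕ r →
                    lookup (flag b (x ∘ σ)) k ≡ lookup (flag b x) k
    flag-∘σ-level {x = x} k k≢r = flag-level-≡ k
      (λ { v (u , u∈E , bu≡v) → u , InE-∘σ⁻ k≢r u∈E , bu≡v })
      (λ { v (u , u∈E , bu≡v) → u , InE-∘σ⁺ k≢r u∈E , bu≡v })

  module _ {n : ℕ} where

    transvection : Fin n → Fin n → F → V n → V n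
    transvection a c α v = v +ᵥ ((α * lookup v c) ·ᵥ e a)

    lookup-transvection : ∀ a c α v r → lookup (transvection a c α v) r ≡ lookup v r + (α * lookup v c) * lookup (e a) r
    lookup-transvection a c α v r = trans (lookup-+ᵥ v _ r) (cong (lookup v r +_) (lookup-·ᵥ _ (e a) r))

    lookup-transvection-≢ : ∀ {a c α v r} → r ≢ a → lookup (transvection a c α v) r ≡ lookup v r
    lookup-transvection-≢ {a} {c} {α} {v} {r} r≢a = trans (lookup-transvection a c α v r)
      (trans (cong (lookup v r +_) (trans (cong ((α * lookup v c) *_) (lookup-e-≢ (r≢a ∘ sym))) (zeroʳ _))) (+-identityʳ _))

    lookup-transvection-≡ : ∀ a c α v → lookup (transvection a c α v) a ≡ lookup v a + α * lookup v c
    lookup-transvection-≡ a c α v = trans (lookup-transvection a c α v a)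
      (cong (lookup v a +_) (trans (cong ((α * lookup v c) *_) (lookup-e-≡ a)) (*-identityʳ _)))

    transvection-fixes : ∀ {a c α v} → lookup v c ≡ 0# → transvection a c α v ≡ v
    transvection-fixes {a} {c} {α} {v} vc≡0 = Vec-ext λ r → begin
      lookup (transvection a c α v) r                ≡⟨ lookup-transvection a c α v r ⟩
      lookup v r + (α * lookup v c) * lookup (e a) r ≡⟨ cong (λ z → lookup v r + (α * z) * lookup (e a) r) vc≡0 ⟩
      lookup v r + (α * 0#) * lookup (e a) r         ≡⟨ cong (λ z → lookup v r + z * lookup (e a) r) (zeroʳ α) ⟩
      lookup v r + 0# * lookup (e a) r               ≡⟨ trans (cong (lookup v r +_) (zeroˡ _)) (+-identityʳ _) ⟩
      lookup v r                                     ∎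
      where open ≡-Reasoning

    transvection-cancel : ∀ {a c} → a ≢ c → ∀ {α β} → α + β ≡ 0# → ∀ v → transvection a c α (transvection a c β v) ≡ v
    transvection-cancel {a} {c} a≢c {α} {β} α+β≡0 v = Vec-ext λ r → begin
      lookup (transvection a c α w) r
        ≡⟨ lookup-transvection a c α w r ⟩
      lookup w r + (α * lookup w c) * lookup (e a) r
        ≡⟨ cong (λ z → lookup w r + (α * z) * lookup (e a) r) (lookup-transvection-≢ {a} {c} {β} {v} (a≢c ∘ sym)) ⟩
      lookup w r + (α * lookup v c) * lookup (e a) r
        ≡⟨ cong (_+ (α * lookup v c) * lookup (e a) r) (lookup-transvection a c β v r) ⟩
      (lookup v r + (β * lookup v c) * lookup (e a) r) + (α * lookup v c) * lookup (e a) r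
        ≡⟨ +-assoc _ _ _ ⟩
      lookup v r + ((β * lookup v c) * lookup (e a) r + (α * lookup v c) * lookup (e a) r)
        ≡⟨ cong (lookup v r +_) (sym (distribʳ _ _ _)) ⟩
      lookup v r + (β * lookup v c + α * lookup v c) * lookup (e a) r
        ≡⟨ cong (λ z → lookup v r + z * lookup (e a) r) (sym (distribʳ _ _ _)) ⟩
      lookup v r + ((β + α) * lookup v c) * lookup (e a) r
        ≡⟨ cong (λ z → lookup v r + (z * lookup v c) * lookup (e a) r) (trans (+-comm β α) α+β≡0) ⟩
      lookup v r + (0# * lookup v c) * lookup (e a) r
        ≡⟨ cong (λ z → lookup v r + z * lookup (e a) r) (zeroˡ _) ⟩
      lookup v r + 0# * lookup (e a) r
        ≡⟨ trans (cong (lookup v r +_) (zeroˡ _)) (+-identityʳ _) ⟩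
      lookup v r ∎
      where
      open ≡-Reasoning
      w = transvection a c β v

    InE-transvection : ∀ {y k a c α u} → (∀ t → k ≤ toℕ t → y t ≢ a) → InE y k u → InE y k (transvection a c α u)
    InE-transvection {a = a} {c} {α} {u} y≢a u∈E .vanishes t k≤t =
      trans (lookup-transvection-≢ {a} {c} {α} {u} (y≢a t k≤t)) (vanishes u∈E t k≤t)

    transvectionMatrix : Fin n → Fin n → F → Mat n
    transvectionMatrix a c α = tabulate λ r → e r +ᵥ ((α * lookup (e a) r) ·ᵥ e c)

    entry-transvectionMatrix : ∀ a c α r l →
      entry (transvectionMatrix a c α) r l ≡ lookup (e r) l + (α * lookup (e a) r) * lookup (e c) l
    entry-transvectionMatrix a c α r l = trans (cong (λ row → lookup row l) (lookup∘tabulate _ r))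
      (trans (lookup-+ᵥ (e r) _ l) (cong (lookup (e r) l +_) (lookup-·ᵥ _ (e c) l)))

    transvectionMatrix-· : ∀ a c α v → transvectionMatrix a c α · v ≡ transvection a c α v
    transvectionMatrix-· a c α v = Vec-ext λ r → begin
      lookup (transvectionMatrix a c α · v) r
        ≡⟨ lookup-· (transvectionMatrix a c α) v r ⟩
      ∑[ l < n ] (entry (transvectionMatrix a c α) r l * lookup v l)
        ≡⟨ sum-cong-≗ (λ l → trans (cong (_* lookup v l) (entry-transvectionMatrix a c α r l)) (distribʳ _ _ _)) ⟩
      ∑[ l < n ] (lookup (e r) l * lookup v l + (β r * lookup (e c) l) * lookup v l)
        ≡⟨ ∑-distrib-+ (λ l → lookup (e r) l * lookup v l) (λ l → (β r * lookup (e c) l) * lookup v l) ⟩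
      ∑[ l < n ] (lookup (e r) l * lookup v l) + ∑[ l < n ] ((β r * lookup (e c) l) * lookup v l)
        ≡⟨ cong₂ _+_ (∑-e* r (lookup v)) (scaled r) ⟩
      lookup v r + β r * lookup v c
        ≡⟨ cong (lookup v r +_) (xy∙z≈xz∙y α _ _) ⟩
      lookup v r + (α * lookup v c) * lookup (e a) r
        ≡⟨ lookup-transvection a c α v r ⟨
      lookup (transvection a c α v) r ∎
      where
      open ≡-Reasoning
      β : Fin n → F
      β r = α * lookup (e a) r
      scaled : ∀ r → ∑[ l < n ] ((β r * lookup (e c) l) * lookup v l) ≡ β r * lookup v c
      scaled r = trans (sum-cong-≗ λ l → *-assoc (β r) (lookup (e c) l) (lookup v l))
        (trans (sym (*-distribˡ-sum (β r) λ l → lookup (e c) l * lookup v l)) (cong (β r *_) (∑-e* c (lookup v))))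

    transvectionMatrix-InB : ∀ {a c} → a < c → ∀ α → InB (transvectionMatrix a c α)
    transvectionMatrix-InB {a} {c} a<c α =
      upper , transvectionMatrix a c (- α) , cancel (-‿inverseʳ α) , cancel (-‿inverseˡ α)
      where
      upper : ∀ r t → t < r → entry (transvectionMatrix a c α) r t ≡ 0#
      upper r t t<r = trans (entry-transvectionMatrix a c α r t)
        (trans (cong₂ _+_ (lookup-e-≢ (Finₚ.<⇒≢ t<r ∘ sym)) off-diagonal) (+-identityˡ 0#))
        where
        off-diagonal : (α * lookup (e a) r) * lookup (e c) t ≡ 0#
        off-diagonal with r ≟ a
        ... | yes refl = trans (cong (_ *_) (lookup-e-≢ (Finₚ.<⇒≢ (Finₚ.<-trans t<r a<c) ∘ sym))) (zeroʳ _)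
        ... | no r≢a   = trans (cong (λ z → (α * z) * lookup (e c) t) (lookup-e-≢ (r≢a ∘ sym)))
                               (trans (cong (_* lookup (e c) t) (zeroʳ α)) (zeroˡ _))
      cancel : ∀ {α β} → α + β ≡ 0# → transvectionMatrix a c α ⊗ transvectionMatrix a c β ≡ Iₙ
      cancel {α} {β} α+β≡0 = ≡-by-columns λ j → begin
        (transvectionMatrix a c α ⊗ transvectionMatrix a c β) · e j
          ≡⟨ ⊗-· _ _ (e j) ⟩
        transvectionMatrix a c α · (transvectionMatrix a c β · e j)
          ≡⟨ cong (transvectionMatrix a c α ·_) (transvectionMatrix-· a c β (e j)) ⟩
        transvectionMatrix a c α · transvection a c β (e j)
          ≡⟨ transvectionMatrix-· a c α _ ⟩
        transvection a c α (transvection a c β (e j))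
          ≡⟨ transvection-cancel (Finₚ.<⇒≢ a<c) α+β≡0 (e j) ⟩
        e j
          ≡⟨ Iₙ-· (e j) ⟨
        Iₙ · e j ∎
        where open ≡-Reasoning

  module AdjacentFlags {m : ℕ} (i : Fin m) {b : Mat (ℕ.suc m)} (b∈B : InB b)
              {y : Fin (ℕ.suc m) → Fin (ℕ.suc m)} (y-perm : IsPermutation y)
              (ascent : y (Letter.l i) < y (Letter.r i)) where

    open Letter i
    open IsPermutation y-perm

    A C : Fin (ℕ.suc m)
    A = y l
    C = y r

    private
      A≢C : A ≢ C
      A≢C = Finₚ.<⇒≢ ascent

      far≢A : ∀ t → ℕ.suc (toℕ r) ≤ toℕ t → y t ≢ A
      far≢A t r<t yt≡A = ℕₚ.<⇒≱ (ℕₚ.<-trans l<r (ℕₚ.n<1+n _)) (subst (λ s → ℕ.suc (toℕ r) ≤ toℕ s) (injective yt≡A) r<t)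

      far≢C : ∀ t → ℕ.suc (toℕ r) ≤ toℕ t → y t ≢ C
      far≢C t r<t yt≡C = ℕₚ.<⇒≱ (ℕₚ.n<1+n _) (subst (λ s → ℕ.suc (toℕ r) ≤ toℕ s) (injective yt≡C) r<t)

      low-or-high : ∀ {k} → k ≢ toℕ r → k ≤ toℕ i ⊎ ℕ.suc (toℕ r) ≤ k
      low-or-high {k} k≢r with ℕₚ.<-cmp k (toℕ r)
      ... | tri< k<r _ _ = inj₁ (ℕₚ.≤-pred k<r)
      ... | tri≈ _ k≡r _ = contradiction k≡r k≢r
      ... | tri> _ _ r<k = inj₂ r<k

    T : F → Mat (ℕ.suc m)
    T α = transvectionMatrix A C α

    private
      bT· : ∀ α u → (b ⊗ T α) · u ≡ b · transvection A C α u
      bT· α u = trans (⊗-· b (T α) u) (cong (b ·_) (transvectionMatrix-· A C α u))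

      transvection-fixes-low : ∀ {α k u} → k ≤ toℕ i → InE y k u → transvection A C α u ≡ u
      transvection-fixes-low {α} {u = u} k≤i u∈E =
        transvection-fixes {a = A} {C} {α} {u} (vanishes u∈E r (ℕₚ.m≤n⇒m≤1+n k≤i))

      InE-transvection-high : ∀ {α k u} → ℕ.suc (toℕ r) ≤ k → InE y k u → InE y k (transvection A C α u)
      InE-transvection-high r<k = InE-transvection (λ t k≤t → far≢A t (ℕₚ.≤-trans r<k k≤t))

      InBE-bT⇒ : ∀ α {k v} → k ≢ toℕ r → InBE (b ⊗ T α) y k v → InBE b y k v
      InBE-bT⇒ α k≢r (u , u∈E , bTu≡v) with low-or-high k≢r
      ... | inj₁ k≤i = u , u∈E , trans (cong (b ·_) (sym (transvection-fixes-low k≤i u∈E))) (trans (sym (bT· α u)) bTu≡v)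
      ... | inj₂ r<k = transvection A C α u , InE-transvection-high r<k u∈E , trans (sym (bT· α u)) bTu≡v

      InBE-bT⇐ : ∀ α {k v} → k ≢ toℕ r → InBE b y k v → InBE (b ⊗ T α) y k v
      InBE-bT⇐ α k≢r (u , u∈E , bu≡v) with low-or-high k≢r
      ... | inj₁ k≤i = u , u∈E , trans (bT· α u) (trans (cong (b ·_) (transvection-fixes-low k≤i u∈E)) bu≡v)
      ... | inj₂ r<k = transvection A C (- α) u , InE-transvection-high r<k u∈E ,
                       trans (bT· α _) (trans (cong (b ·_) (transvection-cancel A≢C (-‿inverseʳ α) u)) bu≡v)

    nextB : Maybe F → Mat (ℕ.suc m)
    nextB nothing  = b
    nextB (just α) = b ⊗ T α

    nextY : Maybe F → Fin (ℕ.suc m) → Fin (ℕ.suc m)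
    nextY nothing  = y
    nextY (just _) = y ∘ σ

    nextB-InB : ∀ ch → InB (nextB ch)
    nextB-InB nothing  = b∈B
    nextB-InB (just α) = ⊗-InB {b = b} {c = T α} b∈B (transvectionMatrix-InB ascent α)

    nextY-isPermutation : ∀ ch → IsPermutation (nextY ch)
    nextY-isPermutation nothing  = y-perm
    nextY-isPermutation (just _) = ∘-involution-isPermutation y-perm σ-involutive

    nextFlag : Maybe F → Flag (ℕ.suc m)
    nextFlag ch = flag (nextB ch) (nextY ch)

    nextFlag-level : ∀ ch k → toℕ k ≢ toℕ r → lookup (nextFlag ch) k ≡ lookup (flag b y) k
    nextFlag-level nothing  k k≢r = refl
    nextFlag-level (just α) k k≢r = trans (flag-∘σ-level i {b = b ⊗ T α} {x = y} k k≢r)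
      (flag-level-≡ {b = b ⊗ T α} {y} {b} {y} k (λ v → InBE-bT⇒ α k≢r) (λ v → InBE-bT⇐ α k≢r))

    -- The q + 1 lines of F_{i+2}/F_i, in coordinates w with b w = v: w_C = 0, or w_A = α w_C.
    OnLine : Maybe F → V (ℕ.suc m) → Set
    OnLine nothing  w = lookup w C ≡ 0#
    OnLine (just α) w = lookup w A ≡ α * lookup w C

    Line : Maybe F → V (ℕ.suc m) → Set
    Line ch v = ∃[ w ] InE y (ℕ.suc (toℕ r)) w × OnLine ch w × b · w ≡ v

    private
      InBE-next⇒Line : ∀ ch {v} → InBE (nextB ch) (nextY ch) (toℕ r) v → Line ch v
      InBE-next⇒Line nothing (w , w∈E , bw≡v) = let w∈E′ , wC≡0 = InE-suc⁻ r refl w∈E in w , w∈E′ , wC≡0 , bw≡v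
      InBE-next⇒Line (just α) (u , u∈E , bTu≡v) =
        transvection A C α u , InE-transvection far≢A u∈E′ , wA≡αwC , trans (sym (bT· α u)) bTu≡v
        where
        split : InE (y ∘ σ) (ℕ.suc (toℕ r)) u × lookup u (y (σ r)) ≡ 0#
        split = InE-suc⁻ r refl u∈E
        u∈E′ : InE y (ℕ.suc (toℕ r)) u
        u∈E′ = InE-∘σ⁻ i {x = y} ℕₚ.1+n≢n (proj₁ split)
        uA≡0 : lookup u A ≡ 0#
        uA≡0 = subst (λ s → lookup u (y s) ≡ 0#) σ-r (proj₂ split)
        wA≡αwC : lookup (transvection A C α u) A ≡ α * lookup (transvection A C α u) C
        wA≡αwC = begin
          lookup (transvection A C α u) A     ≡⟨ lookup-transvection-≡ A C α u ⟩
          lookup u A + α * lookup u C         ≡⟨ trans (cong (_+ α * lookup u C) uA≡0) (+-identityˡ _) ⟩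
          α * lookup u C                      ≡⟨ cong (α *_) (lookup-transvection-≢ {a = A} {C} {α} {u} (A≢C ∘ sym)) ⟨
          α * lookup (transvection A C α u) C ∎
          where open ≡-Reasoning

      Line⇒InBE-next : ∀ ch {v} → Line ch v → InBE (nextB ch) (nextY ch) (toℕ r) v
      Line⇒InBE-next nothing (w , w∈E′ , wC≡0 , bw≡v) = w , InE-suc⁺ r refl w∈E′ wC≡0 , bw≡v
      Line⇒InBE-next (just α) {v} (w , w∈E′ , wA≡αwC , bw≡v) = u , u∈E , bTu≡v
        where
        u = transvection A C (- α) w
        uA≡0 : lookup u A ≡ 0#
        uA≡0 = begin
          lookup u A                        ≡⟨ lookup-transvection-≡ A C (- α) w ⟩
          lookup w A + - α * lookup w C     ≡⟨ cong (_+ - α * lookup w C) wA≡αwC ⟩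
          α * lookup w C + - α * lookup w C ≡⟨ distribʳ _ α (- α) ⟨
          (α + - α) * lookup w C            ≡⟨ trans (cong (_* lookup w C) (-‿inverseʳ α)) (zeroˡ _) ⟩
          0#                                ∎
          where open ≡-Reasoning
        u∈E : InE (y ∘ σ) (toℕ r) u
        u∈E = InE-suc⁺ r refl (InE-∘σ⁺ i {x = y} ℕₚ.1+n≢n (InE-transvection far≢A w∈E′))
                       (subst (λ s → lookup u (y s) ≡ 0#) (sym σ-r) uA≡0)
        bTu≡v : (b ⊗ T α) · u ≡ v
        bTu≡v = trans (bT· α u) (trans (cong (b ·_) (transvection-cancel A≢C (-‿inverseʳ α) w)) bw≡v)

    ∈-nextFlag⁻ : ∀ ch k → toℕ k ≡ toℕ r → ∀ {v} → v ∈ₛ lookup (nextFlag ch) k → Line ch v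
    ∈-nextFlag⁻ ch k k≡r {v} v∈ = InBE-next⇒Line ch (subst (λ j → InBE (nextB ch) (nextY ch) j v) k≡r (∈-flag⁻ k v∈))

    ∈-nextFlag⁺ : ∀ ch k → toℕ k ≡ toℕ r → ∀ {v} → Line ch v → v ∈ₛ lookup (nextFlag ch) k
    ∈-nextFlag⁺ ch k k≡r {v} v∈ = ∈-flag⁺ k (subst (λ j → InBE (nextB ch) (nextY ch) j v) (sym k≡r) (Line⇒InBE-next ch v∈))

    private
      witness : Maybe F → V (ℕ.suc m)
      witness nothing  = e A
      witness (just α) = (α ·ᵥ e A) +ᵥ e C

      lookup-witness : ∀ α j → lookup (witness (just α)) j ≡ α * lookup (e A) j + lookup (e C) j
      lookup-witness α j = trans (lookup-+ᵥ (α ·ᵥ e A) (e C) j) (cong (_+ lookup (e C) j) (lookup-·ᵥ α (e A) j))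

      witness-A : ∀ α → lookup (witness (just α)) A ≡ α
      witness-A α = trans (lookup-witness α A)
        (trans (cong₂ _+_ (trans (cong (α *_) (lookup-e-≡ A)) (*-identityʳ α)) (lookup-e-≢ (A≢C ∘ sym))) (+-identityʳ α))

      witness-C : ∀ α → lookup (witness (just α)) C ≡ 1#
      witness-C α = trans (lookup-witness α C)
        (trans (cong₂ _+_ (trans (cong (α *_) (lookup-e-≢ A≢C)) (zeroʳ α)) (lookup-e-≡ C)) (+-identityˡ 1#))

      witness-InE : ∀ ch → InE y (ℕ.suc (toℕ r)) (witness ch)
      witness-InE nothing  .vanishes t r<t = lookup-e-≢ (far≢A t r<t ∘ sym)
      witness-InE (just α) .vanishes t r<t = trans (lookup-witness α (y t))
        (trans (cong₂ _+_ (trans (cong (α *_) (lookup-e-≢ (far≢A t r<t ∘ sym))) (zeroʳ α)) (lookup-e-≢ (far≢C t r<t ∘ sym)))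
               (+-identityʳ 0#))

      witness-OnLine : ∀ ch → OnLine ch (witness ch)
      witness-OnLine nothing  = lookup-e-≢ A≢C
      witness-OnLine (just α) = trans (witness-A α) (sym (trans (cong (α *_) (witness-C α)) (*-identityʳ α)))

      OnLine-witness⇒≡ : ∀ ch ch′ → OnLine ch′ (witness ch) → ch ≡ ch′
      OnLine-witness⇒≡ nothing  nothing  _  = refl
      OnLine-witness⇒≡ nothing  (just β) on = contradiction 1≡0 (0≢1 ∘ sym)
        where
        open ≡-Reasoning
        1≡0 : 1# ≡ 0#
        1≡0 = begin
          1#                   ≡⟨ lookup-e-≡ A ⟨
          lookup (e A) A       ≡⟨ on ⟩
          β * lookup (e A) C   ≡⟨ cong (β *_) (lookup-e-≢ A≢C) ⟩
          β * 0#               ≡⟨ zeroʳ β ⟩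
          0#                   ∎
      OnLine-witness⇒≡ (just α) nothing  on = contradiction (trans (sym (witness-C α)) on) (0≢1 ∘ sym)
      OnLine-witness⇒≡ (just α) (just β) on = cong just (begin
        α                                ≡⟨ witness-A α ⟨
        lookup (witness (just α)) A      ≡⟨ on ⟩
        β * lookup (witness (just α)) C  ≡⟨ cong (β *_) (witness-C α) ⟩
        β * 1#                           ≡⟨ *-identityʳ β ⟩
        β                                ∎)
        where open ≡-Reasoning

    nextFlag-injective : ∀ ch ch′ → nextFlag ch ≡ nextFlag ch′ → ch ≡ ch′
    nextFlag-injective ch ch′ flag≡ with ∈-nextFlag⁻ ch′ (inject₁ r) (toℕ-inject₁ r)
      (subst (λ Fl → (b · witness ch) ∈ₛ lookup Fl (inject₁ r)) flag≡
        (∈-nextFlag⁺ ch (inject₁ r) (toℕ-inject₁ r) (witness ch , witness-InE ch , witness-OnLine ch , refl)))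
    ... | w′ , _ , w′-on , bw′≡ = OnLine-witness⇒≡ ch ch′ (subst (OnLine ch′) (InB-injective b∈B bw′≡) w′-on)

    module _ {F₁ : Flag (ℕ.suc m)} (F₁-isFlag : IsFlag F₁)
             (F₁-adjacent : ∀ k → toℕ k ≢ toℕ r → lookup (flag b y) k ≡ lookup F₁ k) where

      private
        kₗ kᵣ : Fin (ℕ.suc (ℕ.suc m))
        kₗ = inject₁ l
        kᵣ = inject₁ r

        toℕ-kₗ : toℕ kₗ ≡ toℕ i
        toℕ-kₗ = trans (toℕ-inject₁ l) (toℕ-inject₁ i)

        toℕ-kᵣ : toℕ kᵣ ≡ toℕ r
        toℕ-kᵣ = toℕ-inject₁ r

        U : V (ℕ.suc m) → Set
        U v = v ∈ₛ lookup F₁ kᵣ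

        Fᵢ : V (ℕ.suc m) → Set
        Fᵢ = InBE b y (toℕ i)

        Fᵢ⊆U : ∀ v → Fᵢ v → U v
        Fᵢ⊆U v v∈ = proj₂ F₁-isFlag l v (subst (v ∈ₛ_) (F₁-adjacent kₗ (λ eq → ℕₚ.1+n≢n (trans (sym eq) toℕ-kₗ)))
          (∈-flag⁺ kₗ (subst (λ j → InBE b y j v) (sym toℕ-kₗ) v∈)))

        U⊆Fᵢ₊₂ : ∀ v → U v → InBE b y (ℕ.suc (toℕ r)) v
        U⊆Fᵢ₊₂ v v∈ = ∈-flag⁻ (suc r) (subst (v ∈ₛ_) (sym (F₁-adjacent (suc r) ℕₚ.1+n≢n)) (proj₂ F₁-isFlag r v v∈))

        U-basis : HasDim (lookup F₁ kᵣ) (toℕ kᵣ)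
        U-basis = proj₁ F₁-isFlag kᵣ

        U⇒InSpan : ∀ v → U v → InSpan (proj₁ U-basis) v
        U⇒InSpan v = proj₁ (proj₂ (proj₂ U-basis) v)

        InSpan⇒U : ∀ v → InSpan (proj₁ U-basis) v → U v
        InSpan⇒U v = proj₂ (proj₂ (proj₂ U-basis) v)

        U-card : HasCard U (q ℕ.^ toℕ r)
        U-card = subst (λ j → HasCard U (q ℕ.^ j)) toℕ-kᵣ
          (HasCard-cong InSpan⇒U U⇒InSpan (InSpan-card _ (proj₁ (proj₂ U-basis))))

        Fᵢ-card : HasCard Fᵢ (q ℕ.^ toℕ i)
        Fᵢ-card = subst (λ j → HasCard (InBE b y j) (q ℕ.^ j)) toℕ-kₗ (InBE-card y-perm kₗ b∈B)

        InE-i⁺ : ∀ {w} → InE y (ℕ.suc (toℕ r)) w → lookup w A ≡ 0# → lookup w C ≡ 0# → InE y (toℕ i) w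
        InE-i⁺ w∈E wA≡0 wC≡0 = InE-suc⁺ l (toℕ-inject₁ i) (InE-suc⁺ r refl w∈E wC≡0) wA≡0

        -- If w′ - λ′ w has zero A- and C-coordinates it lies in E^y_i, so b w′ ∈ F_i + F·(b w) ⊆ U.
        module _ {w : V (ℕ.suc m)} (w∈E : InE y (ℕ.suc (toℕ r)) w) (bw∈U : U (b · w)) where

          line⊆U : ∀ λ′ {w′} → InE y (ℕ.suc (toℕ r)) w′ →
                   lookup w′ A + (- λ′) * lookup w A ≡ 0# → lookup w′ C + (- λ′) * lookup w C ≡ 0# → U (b · w′)
          line⊆U λ′ {w′} w′∈E zA≡0 zC≡0 =
            subst U (sym bw′≡) (InSpan⇒U _ (InSpan-+ᵥ (U⇒InSpan _ bz∈U) (InSpan-·ᵥ λ′ (U⇒InSpan _ bw∈U))))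
            where
            z = w′ +ᵥ ((- λ′) ·ᵥ w)
            lookup-z : ∀ j → lookup z j ≡ lookup w′ j + (- λ′) * lookup w j
            lookup-z j = trans (lookup-+ᵥ w′ _ j) (cong (lookup w′ j +_) (lookup-·ᵥ (- λ′) w j))
            z∈E : InE y (ℕ.suc (toℕ r)) z
            z∈E .vanishes t r<t = trans (lookup-z (y t))
              (trans (cong₂ (λ a c → a + (- λ′) * c) (vanishes w′∈E t r<t) (vanishes w∈E t r<t)) (trans (+-identityˡ _) (zeroʳ _)))
            bz∈U : U (b · z)
            bz∈U = Fᵢ⊆U _ (z , InE-i⁺ z∈E (trans (lookup-z A) zA≡0) (trans (lookup-z C) zC≡0) , refl)
            bw′≡ : b · w′ ≡ (b · z) +ᵥ (λ′ ·ᵥ (b · w))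
            bw′≡ = begin
              b · w′                     ≡⟨ cong (b ·_) (u-cw+cw≡u w′ w λ′) ⟨
              b · (z +ᵥ (λ′ ·ᵥ w))       ≡⟨ ·-+ᵥ b z _ ⟩
              (b · z) +ᵥ (b · (λ′ ·ᵥ w)) ≡⟨ cong ((b · z) +ᵥ_) (·-·ᵥ b λ′ w) ⟩
              (b · z) +ᵥ (λ′ ·ᵥ (b · w)) ∎
              where open ≡-Reasoning

          Line-nothing⊆U : lookup w C ≡ 0# → lookup w A ≢ 0# → ∀ v → Line nothing v → U v
          Line-nothing⊆U wC≡0 wA≢0 _ (w′ , w′∈E , w′C≡0 , refl) = line⊆U λ′ w′∈E zA≡0 zC≡0
            where
            wA⁻¹ = proj₁ (inverse (lookup w A) wA≢0)
            λ′ = lookup w′ A * wA⁻¹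
            zA≡0 : lookup w′ A + (- λ′) * lookup w A ≡ 0#
            zA≡0 = x-[x*c⁻¹]*c≡0 (lookup w′ A) (proj₂ (inverse (lookup w A) wA≢0))
            zC≡0 : lookup w′ C + (- λ′) * lookup w C ≡ 0#
            zC≡0 = trans (cong₂ (λ a c → a + (- λ′) * c) w′C≡0 wC≡0) (trans (+-identityˡ _) (zeroʳ _))

          Line-just⊆U : (wC≢0 : lookup w C ≢ 0#) → ∀ v → Line (just (lookup w A * proj₁ (inverse (lookup w C) wC≢0))) v → U v
          Line-just⊆U wC≢0 _ (w′ , w′∈E , w′-on , refl) = line⊆U λ′ w′∈E zA≡0 zC≡0
            where
            open ≡-Reasoning
            wC⁻¹ = proj₁ (inverse (lookup w C) wC≢0)
            λ′ = lookup w′ C * wC⁻¹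
            zA≡0 : lookup w′ A + (- λ′) * lookup w A ≡ 0#
            zA≡0 = begin
              lookup w′ A + (- λ′) * lookup w A
                ≡⟨ cong₂ _+_ w′-on (sym (-‿distribˡ-* λ′ (lookup w A))) ⟩
              (lookup w A * wC⁻¹) * lookup w′ C + - (λ′ * lookup w A)
                ≡⟨ cong (λ z → (lookup w A * wC⁻¹) * lookup w′ C + - z) (xy∙z≈zy∙x (lookup w′ C) wC⁻¹ (lookup w A)) ⟩
              (lookup w A * wC⁻¹) * lookup w′ C + - ((lookup w A * wC⁻¹) * lookup w′ C)
                ≡⟨ -‿inverseʳ _ ⟩
              0# ∎
            zC≡0 : lookup w′ C + (- λ′) * lookup w C ≡ 0#
            zC≡0 = x-[x*c⁻¹]*c≡0 (lookup w′ C) (proj₂ (inverse (lookup w C) wC≢0))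

          choose : ¬ (lookup w A ≡ 0# × lookup w C ≡ 0#) → ∃[ ch ] (∀ v → Line ch v → U v)
          choose w≢0 with lookup w C ≟F 0#
          ... | yes wC≡0 = nothing , Line-nothing⊆U wC≡0 (λ wA≡0 → w≢0 (wA≡0 , wC≡0))
          ... | no wC≢0  = just _ , Line-just⊆U wC≢0

      -- Some b w ∈ U ∖ F_i picks the line ch; then Line ch ⊆ U, and both have q^(i+1) elements.
      adjacent⇒≡nextFlag : ∃[ ch ] F₁ ≡ nextFlag ch
      adjacent⇒≡nextFlag with HasCard-<⇒∃¬ Fᵢ-card U-card (q^n<q^1+n (toℕ i)) (InBE? b y (toℕ i))
      ... | u , u∈U , u∉Fᵢ with U⊆Fᵢ₊₂ u u∈U
      ... | w , w∈E , refl with choose w∈E u∈U (λ (wA≡0 , wC≡0) → u∉Fᵢ (w , InE-i⁺ w∈E wA≡0 wC≡0 , refl))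
      ... | ch , Line⊆U = ch , Vec-ext level-≡
        where
        P : V (ℕ.suc m) → Set
        P = InBE (nextB ch) (nextY ch) (toℕ r)
        P-card : HasCard P (q ℕ.^ toℕ r)
        P-card = subst (λ j → HasCard (InBE (nextB ch) (nextY ch) j) (q ℕ.^ j)) toℕ-kᵣ
                       (InBE-card (nextY-isPermutation ch) kᵣ (nextB-InB ch))
        U⊆P : ∀ v → U v → P v
        U⊆P = HasCard-≥⇒⊇ P-card U-card ℕₚ.≤-refl (λ v → Line⊆U v ∘ InBE-next⇒Line ch) (InBE? _ _ _)
        level-≡ : ∀ k → lookup F₁ k ≡ lookup (nextFlag ch) k
        level-≡ k with toℕ k ℕ.≟ toℕ r
        ... | no k≢r = trans (sym (F₁-adjacent k k≢r)) (sym (nextFlag-level ch k k≢r))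
        ... | yes k≡r with toℕ-injective {i = k} {kᵣ} (trans k≡r (sym toℕ-kᵣ))
        ... | refl = Subset-ext
          (λ v v∈ → ∈-flag⁺ kᵣ (subst (λ j → InBE (nextB ch) (nextY ch) j v) (sym toℕ-kᵣ) (U⊆P v v∈)))
          (λ v v∈ → Line⊆U v (∈-nextFlag⁻ ch kᵣ toℕ-kᵣ v∈))

module BottSamelson (𝔽 : FiniteField) where

  open Flags 𝔽
  open FiniteField 𝔽 using (F; elems; complete; unique; q)
  open Geometry 𝔽
  open import Data.Nat using (_+_; _*_; _^_)

  shorter longer : ∀ {m} → Fin m → (Fin (ℕ.suc m) → Fin (ℕ.suc m)) → Fin (ℕ.suc m) → Fin (ℕ.suc m)
  shorter i x = if γ x i then x else x ∘ sᵢ i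
  longer  i x = if γ x i then x ∘ sᵢ i else x

  module _ {m} (i : Fin m) {x : Fin (ℕ.suc m) → Fin (ℕ.suc m)} (x-perm : IsPermutation x) where
    open Letter i
    open IsPermutation x-perm

    shorter-isPermutation : IsPermutation (shorter i x)
    shorter-isPermutation with γ x i
    ... | true  = x-perm
    ... | false = ∘-involution-isPermutation x-perm σ-involutive

    longer-isPermutation : IsPermutation (longer i x)
    longer-isPermutation with γ x i
    ... | true  = ∘-involution-isPermutation x-perm σ-involutive
    ... | false = x-perm

    shorter-ascent : shorter i x l < shorter i x r
    shorter-ascent with γ x i in γ≡
    ... | true  = γ≡true⇒ascent injective γ≡
    ... | false = subst₂ _<_ (cong x (sym σ-l)) (cong x (sym σ-r)) (γ≡false⇒descent injective γ≡)

    longer≗shorter∘σ : longer i x ≗ shorter i x ∘ σ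
    longer≗shorter∘σ t with γ x i
    ... | true  = refl
    ... | false = cong x (sym (σ-involutive t))

    flag-shorter-level : ∀ b (k : Fin (ℕ.suc (ℕ.suc m))) → toℕ k ≢ toℕ r →
                         lookup (flag b (shorter i x)) k ≡ lookup (flag b x) k
    flag-shorter-level b k k≢r with γ x i
    ... | true  = refl
    ... | false = flag-∘σ-level i k k≢r

  record State (n : ℕ) : Set where
    constructor state
    field
      b      : Mat n
      b∈B    : InB b
      x      : Fin n → Fin n
      x-perm : IsPermutation x

  stateFlag : ∀ {n} → State n → Flag n
  stateFlag st = flag (State.b st) (State.x st)

  Adjacent : ∀ {n} → Fin (ℕ.pred n) → Flag n → Flag n → Set
  Adjacent {n} i F₀ F₁ = ∀ (k : Fin (ℕ.suc n)) → toℕ k ≢ ℕ.suc (toℕ i) → lookup F₀ k ≡ lookup F₁ k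

  module Successors {m} (st : State (ℕ.suc m)) (i : Fin m) where
    open State st
    private
      module S = AdjacentFlags i {b} b∈B {shorter i x} (shorter-isPermutation i x-perm) (shorter-ascent i x-perm)

    next : Maybe F → State (ℕ.suc m)
    next nothing  = state b b∈B (shorter i x) (shorter-isPermutation i x-perm)
    next (just α) = state (S.nextB (just α)) (S.nextB-InB (just α)) (longer i x) (longer-isPermutation i x-perm)

    stateFlag-next : ∀ ch → stateFlag (next ch) ≡ S.nextFlag ch
    stateFlag-next nothing  = refl
    stateFlag-next (just α) = flag-cong (S.nextB (just α)) (longer≗shorter∘σ i x-perm)

    next-adjacent : ∀ ch → Adjacent i (stateFlag st) (stateFlag (next ch))
    next-adjacent ch k k≢r = sym (begin
      lookup (stateFlag (next ch)) k  ≡⟨ cong (λ Fl → lookup Fl k) (stateFlag-next ch) ⟩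
      lookup (S.nextFlag ch) k        ≡⟨ S.nextFlag-level ch k k≢r ⟩
      lookup (flag b (shorter i x)) k ≡⟨ flag-shorter-level i x-perm b k k≢r ⟩
      lookup (stateFlag st) k         ∎)
      where open ≡-Reasoning

    next-injective : ∀ ch ch′ → stateFlag (next ch) ≡ stateFlag (next ch′) → ch ≡ ch′
    next-injective ch ch′ eq =
      S.nextFlag-injective ch ch′ (trans (sym (stateFlag-next ch)) (trans eq (stateFlag-next ch′)))

    adjacent⇒≡next : ∀ {F₁} → IsFlag F₁ → Adjacent i (stateFlag st) F₁ → ∃[ ch ] F₁ ≡ stateFlag (next ch)
    adjacent⇒≡next {F₁} F₁-isFlag adj =
      let ch , F₁≡ = S.adjacent⇒≡nextFlag {F₁} F₁-isFlag adjacent in ch , trans F₁≡ (sym (stateFlag-next ch))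
      where
      adjacent : ∀ k → toℕ k ≢ toℕ (Letter.r i) → lookup (flag b (shorter i x)) k ≡ lookup F₁ k
      adjacent k k≢r = trans (flag-shorter-level i x-perm b k k≢r) (adj k k≢r)

  IsGallery : ∀ {n} (R : Word n) → Vec (Flag n) (ℕ.suc (length R)) → Set
  IsGallery []      (F ∷ [])       = IsFlag F
  IsGallery (i ∷ R) (F₀ ∷ F₁ ∷ Fs) = IsFlag F₀ × Adjacent i F₀ F₁ × IsGallery R (F₁ ∷ Fs)

  IsGallery-head : ∀ {n} (R : Word n) {Fs : Vec (Flag n) (ℕ.suc (length R))} → IsGallery R Fs → IsFlag (Vec.head Fs)
  IsGallery-head []      {F ∷ []}       F-isFlag        = F-isFlag
  IsGallery-head (i ∷ R) {F₀ ∷ F₁ ∷ Fs} (F₀-isFlag , _) = F₀-isFlag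

  IsGallery⇒ : ∀ {n} (R : Word n) {Fs : Vec (Flag n) (ℕ.suc (length R))} → IsGallery R Fs →
               (∀ j → IsFlag (lookup Fs j)) ×
               (∀ (j : Fin (length R)) (k : Fin (ℕ.suc n)) → toℕ k ≢ ℕ.suc (toℕ (List.lookup R j)) →
                  lookup (lookup Fs (inject₁ j)) k ≡ lookup (lookup Fs (suc j)) k)
  IsGallery⇒ []      {F ∷ []}       F-isFlag = (λ { zero → F-isFlag }) , λ ()
  IsGallery⇒ (i ∷ R) {F₀ ∷ F₁ ∷ Fs} (F₀-isFlag , adj , gallery) =
    (λ { zero → F₀-isFlag ; (suc j) → proj₁ rest j }) , (λ { zero → adj ; (suc j) → proj₂ rest j })
    where rest = IsGallery⇒ R gallery

  IsGallery⇐ : ∀ {n} (R : Word n) {Fs : Vec (Flag n) (ℕ.suc (length R))} → (∀ j → IsFlag (lookup Fs j)) →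
               (∀ (j : Fin (length R)) (k : Fin (ℕ.suc n)) → toℕ k ≢ ℕ.suc (toℕ (List.lookup R j)) →
                  lookup (lookup Fs (inject₁ j)) k ≡ lookup (lookup Fs (suc j)) k) →
               IsGallery R Fs
  IsGallery⇐ []      {F ∷ []}       flags adj = flags zero
  IsGallery⇐ (i ∷ R) {F₀ ∷ F₁ ∷ Fs} flags adj = flags zero , adj zero , IsGallery⇐ R (flags ∘ suc) (adj ∘ suc)

  FiberPoint : ∀ {n} → State n → (R : Word n) → (Fin n → Fin n) → Vec (Flag n) (ℕ.suc (length R)) → Set
  FiberPoint st R w Fs = Vec.head Fs ≡ stateFlag st × IsGallery R Fs × InSchubertCell w (Vec.last Fs)

  choices : List (Maybe F)
  choices = nothing ∷ List.map just elems

  ∈-choices : ∀ ch → ch ∈ choices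
  ∈-choices nothing  = here refl
  ∈-choices (just α) = there (∈-map⁺ just (complete α))

  choices-unique : Unique choices
  choices-unique = All.tabulate (λ ch∈ nothing≡ch → nothing≢just (∈-map⁻ just ch∈) nothing≡ch)
                 ∷ Uniqueₚ.map⁺ (λ { refl → refl }) unique
    where
    nothing≢just : ∀ {ch} → ∃[ α ] α ∈ elems × ch ≡ just α → nothing ≢ ch
    nothing≢just (_ , _ , refl) ()

  fiberPoints : ∀ {n} → State n → (R : Word n) → (Fin n → Fin n) → List (Vec (Flag n) (ℕ.suc (length R)))
  fiberPoints st []                   w = if State.x st ≈? w then (stateFlag st ∷ []) ∷ [] else []
  fiberPoints {ℕ.suc m} st (i ∷ R) w =
    List.map (stateFlag st ∷_) (List.concatMap (λ ch → fiberPoints (Successors.next st i ch) R w) choices)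

  consGallery : ∀ {m} {i : Fin m} {R : Word (ℕ.suc m)} {F₀ : Flag (ℕ.suc m)} (Fs : Vec (Flag (ℕ.suc m)) (ℕ.suc (length R))) →
                IsFlag F₀ → Adjacent i F₀ (Vec.head Fs) → IsGallery R Fs → IsGallery (i ∷ R) (F₀ ∷ Fs)
  consGallery (F₁ ∷ Fs) F₀-isFlag adj gallery = F₀-isFlag , adj , gallery

  ∈-fiberPoints⁻ : ∀ {n} {w : Fin n → Fin n} → IsPermutation w → ∀ (st : State n) R {Fs} →
                   Fs ∈ fiberPoints st R w → FiberPoint st R w Fs
  ∈-fiberPoints⁻ {w = w} w-perm (state b b∈B x x-perm) [] Fs∈ with x ≈? w in x≈?w
  ∈-fiberPoints⁻ {w = w} w-perm (state b b∈B x x-perm) [] (here refl) | true =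
    refl , flag-isFlag {b = b} b∈B x-perm ,
    subst (InSchubertCell w) (flag-cong b (sym ∘ ≈?⇒≗ x≈?w)) (flag-InSchubertCell w-perm b∈B)
  ∈-fiberPoints⁻ {ℕ.suc m} {w} w-perm st@(state b b∈B x x-perm) (i ∷ R) Fs∈ with ∈-map⁻ (stateFlag st ∷_) Fs∈
  ... | Fs′ , Fs′∈ , refl with ∈-concatMap⁻ (λ ch → fiberPoints (Successors.next st i ch) R w) choices Fs′∈
  ... | ch , _ , Fs′∈′ with ∈-fiberPoints⁻ w-perm (Successors.next st i ch) R Fs′∈′
  ... | head≡ , gallery , cell =
    refl , consGallery Fs′ (flag-isFlag {b = b} b∈B x-perm) adjacent gallery , cell
    where
    open Successors st i
    adjacent : Adjacent i (stateFlag st) (Vec.head Fs′)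
    adjacent = subst (Adjacent i (stateFlag st)) (sym head≡) (next-adjacent ch)

  ∈-fiberPoints⁺ : ∀ {n} {w : Fin n → Fin n} → IsPermutation w → ∀ (st : State n) R {Fs} →
                   FiberPoint st R w Fs → Fs ∈ fiberPoints st R w
  ∈-fiberPoints⁺ {w = w} w-perm st@(state b b∈B x x-perm) [] {F ∷ []} (refl , _ , cell) =
    let b′ , b′∈B , flag≡ = InSchubertCell⇒≡flag w-perm cell
        x≗w = flag-injective {b = b} {b′} b∈B b′∈B x-perm w-perm flag≡
    in subst (λ c → (stateFlag st ∷ []) ∈ (if c then (stateFlag st ∷ []) ∷ [] else [])) (sym (≗⇒≈? x≗w)) (here refl)
  ∈-fiberPoints⁺ {ℕ.suc m} {w} w-perm st (i ∷ R) {F₀ ∷ F₁ ∷ Fs} (refl , (_ , adj , gallery) , cell) =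
    let ch , F₁≡ = adjacent⇒≡next (IsGallery-head R gallery) adj
    in ∈-map⁺ (stateFlag st ∷_) (∈-concatMap⁺ (λ ch → fiberPoints (next ch) R w) (∈-choices ch)
         (∈-fiberPoints⁺ w-perm (next ch) R (F₁≡ , gallery , cell)))
    where open Successors st i

  fiberPoints-unique : ∀ {n} {w : Fin n → Fin n} → IsPermutation w → ∀ (st : State n) R → Unique (fiberPoints st R w)
  fiberPoints-unique {w = w} w-perm st [] with State.x st ≈? w
  ... | true  = All.[] ∷ []
  ... | false = []
  fiberPoints-unique {ℕ.suc m} {w} w-perm st (i ∷ R) =
    Uniqueₚ.map⁺ Vecₚ.∷-injectiveʳ (Uniqueₚ.concat⁺ {xss = List.map points choices}
      (Allₚ.map⁺ {xs = choices} {f = points} (All.tabulate λ {ch} _ → fiberPoints-unique w-perm (next ch) R))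
      (AllPairsₚ.map⁺ (AllPairs.map disjoint choices-unique)))
    where
    open Successors st i
    points : Maybe F → List (Vec (Flag (ℕ.suc m)) (ℕ.suc (length R)))
    points ch = fiberPoints (next ch) R w
    disjoint : ∀ {ch ch′} → ch ≢ ch′ → ∀ {Fs} → ¬ (Fs ∈ fiberPoints (next ch) R w × Fs ∈ fiberPoints (next ch′) R w)
    disjoint {ch} {ch′} ch≢ch′ (Fs∈ , Fs∈′) = ch≢ch′ (next-injective ch ch′
      (trans (sym (proj₁ (∈-fiberPoints⁻ w-perm (next ch) R Fs∈))) (proj₁ (∈-fiberPoints⁻ w-perm (next ch′) R Fs∈′))))

  count : ∀ {n} → (Fin n → Fin n) → Word n → (Fin n → Fin n) → ℕ
  count           x []      w = if x ≈? w then 1 else 0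
  count {ℕ.suc m} x (i ∷ R) w = count (shorter i x) R w + q * count (longer i x) R w

  length-fiberPoints : ∀ {n} (st : State n) R w → length (fiberPoints st R w) ≡ count (State.x st) R w
  length-fiberPoints st [] w = if-float length (State.x st ≈? w)
  length-fiberPoints {ℕ.suc m} st (i ∷ R) w = begin
    length (List.map (stateFlag st ∷_) (List.concatMap points choices))
      ≡⟨ Listₚ.length-map _ (List.concatMap points choices) ⟩
    length (points nothing ++ List.concatMap points (List.map just elems))
      ≡⟨ Listₚ.length-++ (points nothing) ⟩
    length (points nothing) + length (List.concatMap points (List.map just elems))
      ≡⟨ cong₂ _+_ (length-fiberPoints (next nothing) R w)
                   (length-concatMap-map points just (λ α → length-fiberPoints (next (just α)) R w) elems) ⟩
    count (shorter i (State.x st)) R w + q * count (longer i (State.x st)) R w ∎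
    where
    open ≡-Reasoning
    open Successors st i
    points = λ ch → fiberPoints (next ch) R w

  -- wt q R w is wtFrom id 0 R (w ⟨$⟩ʳ_); allowing any start x_0 = x, d_0 = d makes it recursive in R.
  wtFrom : ∀ {n} → (Fin n → Fin n) → ℕ → (R : Word n) → (Fin n → Fin n) → ℕ
  wtFrom x d R w = sum (List.map (λ T → if (x ∘ subwordProd R T) ≈? w then q ^ dWalk x d R T else 0)
                                 (allSubwords (length R)))

  wtFrom-∷ : ∀ {m} (x : Fin (ℕ.suc m) → Fin (ℕ.suc m)) d i R w →
             wtFrom x d (i ∷ R) w ≡ wtFrom x (if eqB false (γ x i) then ℕ.suc d else d) R w
                                    + wtFrom (x ∘ sᵢ i) (if eqB true (γ x i) then ℕ.suc d else d) R w
  wtFrom-∷ x d i R w = begin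
    sum (List.map term (List.map (false ∷_) Ts ++ List.map (true ∷_) Ts))
      ≡⟨ cong sum (Listₚ.map-++ term (List.map (false ∷_) Ts) _) ⟩
    sum (List.map term (List.map (false ∷_) Ts) ++ List.map term (List.map (true ∷_) Ts))
      ≡⟨ ListActionₚ.sum-++ (List.map term (List.map (false ∷_) Ts)) _ ⟩
    sum (List.map term (List.map (false ∷_) Ts)) + sum (List.map term (List.map (true ∷_) Ts))
      ≡⟨ cong₂ _+_ (cong sum (sym (Listₚ.map-∘ Ts))) (cong sum (sym (Listₚ.map-∘ Ts))) ⟩
    wtFrom x _ R w + wtFrom (x ∘ sᵢ i) _ R w ∎
    where
    open ≡-Reasoning
    Ts = allSubwords (length R)
    term : Vec Bool (ℕ.suc (length R)) → ℕ
    term T = if (x ∘ subwordProd (i ∷ R) T) ≈? w then q ^ dWalk x d (i ∷ R) T else 0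

  count-weighted : ∀ {n} (x : Fin n → Fin n) d R w → count x R w * q ^ d ≡ wtFrom x d R w
  count-weighted x d [] w = by-cases (x ≈? w)
    where
    by-cases : ∀ g → (if g then 1 else 0) * q ^ d ≡ (if g then q ^ d else 0) + 0
    by-cases true  = trans (ℕₚ.*-identityˡ _) (sym (ℕₚ.+-identityʳ _))
    by-cases false = refl
  count-weighted {ℕ.suc m} x d (i ∷ R) w = begin
    (count (shorter i x) R w + q * count (longer i x) R w) * q ^ d
      ≡⟨ cong₂ (λ a b → (a + q * b) * q ^ d) (if-float (λ y → count y R w) (γ x i)) (if-float (λ y → count y R w) (γ x i)) ⟩
    ((if γ x i then cx else cxσ) + q * (if γ x i then cxσ else cx)) * q ^ d
      ≡⟨ by-cases (γ x i) ⟩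
    cx * q ^ (if eqB false (γ x i) then ℕ.suc d else d) + cxσ * q ^ (if eqB true (γ x i) then ℕ.suc d else d)
      ≡⟨ cong₂ _+_ (count-weighted x _ R w) (count-weighted (x ∘ sᵢ i) _ R w) ⟩
    wtFrom x _ R w + wtFrom (x ∘ sᵢ i) _ R w
      ≡⟨ wtFrom-∷ x d i R w ⟨
    wtFrom x d (i ∷ R) w
      ∎
    where
    open ≡-Reasoning
    open +-*-Solver using (solve; _:+_; _:*_; _:=_)
    cx = count x R w
    cxσ = count (x ∘ sᵢ i) R w
    by-cases : ∀ g → ((if g then cx else cxσ) + q * (if g then cxσ else cx)) * q ^ d ≡
                     cx * q ^ (if eqB false g then ℕ.suc d else d) + cxσ * q ^ (if eqB true g then ℕ.suc d else d)
    by-cases true  = solve 4 (λ a b q p → (a :+ q :* b) :* p := a :* p :+ b :* (q :* p)) refl cx cxσ q (q ^ d)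
    by-cases false = solve 4 (λ a b q p → (b :+ q :* a) :* p := a :* (q :* p) :+ b :* p) refl cx cxσ q (q ^ d)

  initialState : ∀ {n} → State n
  initialState = state Iₙ Iₙ-InB id id-isPermutation

  ⟨$⟩ʳ-isPermutation : ∀ {n} (w : Permutation′ n) → IsPermutation (w ⟨$⟩ʳ_)
  ⟨$⟩ʳ-isPermutation w = record { from = w ⟨$⟩ˡ_ ; strictlyInverseˡ = λ _ → inverseʳ w ; strictlyInverseʳ = λ _ → inverseˡ w }

  BSFiber⇒FiberPoint : ∀ {n} (R : Word n) (w : Permutation′ n) Fs → BSFiber R w Fs → FiberPoint initialState R (w ⟨$⟩ʳ_) Fs
  BSFiber⇒FiberPoint R w (F ∷ Fs) ((flags , std , adj) , cell) =
    isStandard⇒≡flag-Iₙ-id std , IsGallery⇐ R flags adj , cell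

  FiberPoint⇒BSFiber : ∀ {n} (R : Word n) (w : Permutation′ n) Fs → FiberPoint initialState R (w ⟨$⟩ʳ_) Fs → BSFiber R w Fs
  FiberPoint⇒BSFiber R w (F ∷ Fs) (refl , gallery , cell) =
    (proj₁ (IsGallery⇒ R gallery) , flag-Iₙ-id-isStandard , proj₂ (IsGallery⇒ R gallery)) , cell

  card-BSFiber≡wt : ∀ {n} (R : Word n) (w : Permutation′ n) {N} → HasCard (BSFiber R w) N → N ≡ wt q R w
  card-BSFiber≡wt {n} R w {N} card = begin
    N                      ≡⟨ HasCard-≡ card (HasCard-∈ (fiberPoints-unique w-perm initialState R)) BSFiber⇒∈ ∈⇒BSFiber ⟩
    length points          ≡⟨ length-fiberPoints initialState R w′ ⟩
    count id R w′          ≡⟨ ℕₚ.*-identityʳ _ ⟨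
    count id R w′ * q ^ 0  ≡⟨ count-weighted id 0 R w′ ⟩
    wt q R w               ∎
    where
    open ≡-Reasoning
    w′ : Fin n → Fin n
    w′ = w ⟨$⟩ʳ_
    w-perm : IsPermutation w′
    w-perm = ⟨$⟩ʳ-isPermutation w
    points : List (Vec (Flag n) (ℕ.suc (length R)))
    points = fiberPoints initialState R w′
    BSFiber⇒∈ : ∀ Fs → BSFiber R w Fs → Fs ∈ points
    BSFiber⇒∈ Fs = ∈-fiberPoints⁺ w-perm initialState R ∘ BSFiber⇒FiberPoint R w Fs
    ∈⇒BSFiber : ∀ Fs → Fs ∈ points → BSFiber R w Fs
    ∈⇒BSFiber Fs = FiberPoint⇒BSFiber R w Fs ∘ ∈-fiberPoints⁻ w-perm initialState R

proposition3p4 : (n : ℕ) (R : Word n) (𝔽 : FiniteField) (w : Permutation′ n) (N : ℕ) →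
    HasCard (Geometry.BSFiber 𝔽 R w) N →
    over1+q^ N (FiniteField.q 𝔽) (length R) ≡ over1+q^ (wt (FiniteField.q 𝔽) R w) (FiniteField.q 𝔽) (length R)
proposition3p4 n R 𝔽 w N hasCard =
  cong (λ N → over1+q^ N (FiniteField.q 𝔽) (length R)) (BottSamelson.card-BSFiber≡wt 𝔽 R w hasCard)
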